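{- Let $n\ge1$ be an integer and fix a primitive $n$-th root of unity $\zeta_n$. Let $Y=\mathrm{Spec}\,\mathbb Z[y]$ with the Chebyshev operators $\psi_m$, let $Y(n)=\mathrm{Spec}\,\mathbb Z[y]/I$ with $I=\big(\psi_a(y)-\psi_b(y):a,b\ge1,\ a\equiv\pm b\bmod n\big)$, and let $Y[n]=\mathrm{Spec}\,\mathbb Z[y]/(\psi_n(y)-2)$. Then: (1) $Y(n)$ is flat over $\mathbb Z$ and reduced, and the inclusion $Y(n)\to Y[n]_{\mathrm{red}}$ of closed subschemes of $Y$ is an isomorphism. (2) The ring map $\mathcal O(Y(n))=\mathbb Z[y]/I\to\mathbb Z[x]/(x^n-1)$ sending $y\mapsto x+x^{ -1}$ is well defined and injective. If $n$ is odd, its image is the subring of invariants of the involution $\sigma:x\mapsto x^{ -1}$. If $n$ is even, its image is the $\mathbb Z$-span of $\{1,\ x+x^{ -1},\dots,x^{n/2-1}+x^{1-n/2},\ 2x^{n/2}\}$.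
   Context: For each integer $m\ge1$, $\psi_m(y)\in\mathbb Z[y]$ is the unique polynomial with $\psi_m(x+x^{ -1})=x^m+x^{ -m}$ in $\mathbb Z[x^{\pm1}]$ (Chebyshev polynomials; e.g. $\psi_2=y^2-2$, $\psi_3=y^3-3y$). The $\psi_p$ for primes $p$ form the Chebyshev $\Lambda_{\mathbb Z}$-structure on $\mathbb Z[y]$, and $Y(n)$ is its periodic locus for the cycle $(n)$ (two positive integers $a,b$ are $(n)$-equivalent iff $a\equiv\pm b\bmod n$), while $Y[n]$ is the $(n)$-torsion locus. $Y[n]_{\mathrm{red}}$ denotes the reduced closed subscheme. -}

module Defs where

open import Data.Nat as ℕ using (ℕ; zero; suc)
open import Data.Integer as ℤ using (ℤ; +_)
open import Data.Integer.Divisibility using () renaming (_∣_ to _∣ℤ_)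
open import Data.List using (List; []; _∷_; map; foldr; upTo)
open import Data.List.Relation.Unary.All using (All)
open import Data.Product using (Σ; _×_; _,_; proj₁; proj₂; ∃)
open import Data.Sum using (_⊎_)
open import Relation.Binary.PropositionalEquality using (_≡_)

-- Polynomials over ℤ in one variable, as coefficient lists
-- (lowest degree first).  Equality is coefficientwise (trailing zeros
-- are irrelevant).

Poly : Set
Poly = List ℤ

coeff : Poly → ℕ → ℤ
coeff []       _       = + 0
coeff (a ∷ p)  zero    = a
coeff (a ∷ p)  (suc i) = coeff p i

infix 4 _≈ᴾ_
_≈ᴾ_ : Poly → Poly → Set
p ≈ᴾ q = ∀ i → coeff p i ≡ coeff q i

infixl 6 _+ᴾ_ _-ᴾ_
infixl 7 _*ᴾ_ _·ᴾ_
infixr 8 _^ᴾ_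

_+ᴾ_ : Poly → Poly → Poly
[]      +ᴾ q       = q
(a ∷ p) +ᴾ []      = a ∷ p
(a ∷ p) +ᴾ (b ∷ q) = (a ℤ.+ b) ∷ (p +ᴾ q)

-ᴾ_ : Poly → Poly
-ᴾ p = map ℤ.-_ p

_-ᴾ_ : Poly → Poly → Poly
p -ᴾ q = p +ᴾ (-ᴾ q)

_·ᴾ_ : ℤ → Poly → Poly
c ·ᴾ p = map (c ℤ.*_) p

_*ᴾ_ : Poly → Poly → Poly
[]      *ᴾ q = []
(a ∷ p) *ᴾ q = (a ·ᴾ q) +ᴾ (+ 0 ∷ (p *ᴾ q))

constᴾ : ℤ → Poly
constᴾ c = c ∷ []

-- the variable (called y in ℤ[y], x in ℤ[x])
X : Poly
X = + 0 ∷ + 1 ∷ []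

_^ᴾ_ : Poly → ℕ → Poly
p ^ᴾ zero  = constᴾ (+ 1)
p ^ᴾ suc k = p *ᴾ (p ^ᴾ k)

_∘ᴾ_ : Poly → Poly → Poly
[]      ∘ᴾ q = []
(a ∷ p) ∘ᴾ q = constᴾ a +ᴾ (q *ᴾ (p ∘ᴾ q))

sumᴾ : List Poly → Poly
sumᴾ = foldr _+ᴾ_ []

_∈⟨_⟩ : Poly → (Poly → Set) → Set
f ∈⟨ G ⟩ = Σ (List (Poly × Poly)) λ cs →
             All (λ c → G (proj₂ c)) cs ×
             (f ≈ᴾ sumᴾ (map (λ c → proj₁ c *ᴾ proj₂ c) cs))

_∈√⟨_⟩ : Poly → (Poly → Set) → Set
f ∈√⟨ G ⟩ = ∃ λ k → (f ^ᴾ k) ∈⟨ G ⟩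

-- Chebyshev polynomials ψ_m, characterised by ψ_m(x + x⁻¹) = xᵐ + x⁻ᵐ;
-- computed via ψ₀ = 2, ψ₁ = y, ψ_{m+2} = y ψ_{m+1} − ψ_m.

ψ : ℕ → Poly
ψ zero          = constᴾ (+ 2)
ψ (suc zero)    = X
ψ (suc (suc m)) = (X *ᴾ ψ (suc m)) -ᴾ ψ m

_≡±_mod_ : ℕ → ℕ → ℕ → Set
a ≡± b mod n = ((+ n) ∣ℤ ((+ a) ℤ.- (+ b))) ⊎ ((+ n) ∣ℤ ((+ a) ℤ.+ (+ b)))

GenI : ℕ → Poly → Set
GenI n h = Σ ℕ λ a → Σ ℕ λ b →
             (1 ℕ.≤ a) × (1 ℕ.≤ b) × (a ≡± b mod n) × (h ≈ᴾ (ψ a -ᴾ ψ b))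

GenTors : ℕ → Poly → Set
GenTors n h = h ≈ᴾ (ψ n -ᴾ constᴾ (+ 2))

GenCyc : ℕ → Poly → Set
GenCyc n h = h ≈ᴾ ((X ^ᴾ n) -ᴾ constᴾ (+ 1))

_≡_modCyc_ : Poly → Poly → ℕ → Set
p ≡ q modCyc n = (p -ᴾ q) ∈⟨ GenCyc n ⟩

-- the map ℤ[y] → ℤ[x]/(xⁿ−1), y ↦ x + x⁻¹ = x + x^{n−1}
φ : ℕ → Poly → Poly
φ n f = f ∘ᴾ (X +ᴾ (X ^ᴾ (n ℕ.∸ 1)))

-- the involution σ : x ↦ x⁻¹ = x^{n−1} on ℤ[x]/(xⁿ−1)
σ : ℕ → Poly → Poly
σ n g = g ∘ᴾ (X ^ᴾ (n ℕ.∸ 1))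

-- for n = 2m: the element
--   a₀·1 + Σ_{k=1}^{m−1} a_k (x^k + x^{−k}) + b·(2 x^m)
-- of the ℤ-span of {1, x+x⁻¹, …, x^{m−1}+x^{1−m}, 2x^m}
basisEven : ℕ → ℕ → Poly
basisEven n zero    = constᴾ (+ 1)
basisEven n (suc k) = (X ^ᴾ suc k) +ᴾ (X ^ᴾ (n ℕ.∸ suc k))

spanEven : (m : ℕ) → (ℕ → ℤ) → ℤ → Poly
spanEven m a b =
  sumᴾ (map (λ k → a k ·ᴾ basisEven (2 ℕ.* m) k) (upTo m))
  +ᴾ (b ·ᴾ ((+ 2) ·ᴾ (X ^ᴾ m)))

-- Let n = 1 + n′ and c = ⌊n/2⌋.  Modulo D = ψ_{c+1} − ψ_{n−c−1}, the Chebyshev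
-- recurrence ψₖ₊₂ = y ψₖ₊₁ − ψₖ spreads the two congruences ψ_c ≡ ψ_{n−c} and
-- ψ_{c+1} ≡ ψ_{n−c−1} (one is trivial, the other is D ≡ 0) to ψⱼ ≡ ψₙ₋ⱼ for all
-- j ≤ n, and then to ψₖ₊ₙ ≡ ψₖ.  An equivalence relation on ℕ closed under these
-- two moves contains (n)-equivalence, so I = (D) and 1, ψ₁, …, ψ_c span ℤ[y]/I.
-- The map φ : y ↦ x + x⁻¹ kills I and sends the spanning set to 1 and xᵏ + x⁻ᵏ;
-- the constant term of φ(f g) is a bilinear form on ℤ[y]/I which is diagonal with
-- positive entries on the spanning set.  Hence the constant term of φ(f²) vanishes
-- only for f ∈ I, which gives reducedness, torsion-freeness and injectivity of φ at
-- once.  As D² = (ψₙ − 2)(ψₑ − 2) with e = 2c + 2 − n and ψₙ − 2 ∈ I, the reduced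
-- ideal I is the radical of (ψₙ − 2).  The image of φ is read off the spanning set:
-- for n even ψ_c ↦ 2xᶜ, and for n odd comparing coefficients modulo xⁿ − 1 shows
-- that every σ-invariant element is hit.

{-# OPTIONS --safe #-}
module Submission where

open import Defs
open import Algebra.Bundles using (CommutativeMonoid; CommutativeRing)
import Algebra.Properties.CommutativeSemigroup as CommSemigroupProperties
open import Data.Empty using (⊥-elim)
open import Data.Integer as ℤ using (ℤ; +_; -[1+_]; 0ℤ)
import Data.Integer.Properties as ℤₚ
open import Data.List using (List; []; _∷_; map; _++_; applyUpTo; upTo)
open import Data.List.Relation.Unary.All using (All; []; _∷_)
import Data.List.Relation.Unary.All.Properties as All
open import Data.Maybe using (Maybe; just; nothing)
open import Data.Nat as ℕ using (ℕ; zero; suc; _+_; _∸_; _*_; _≤_; _<_; s≤s; z≤n; _%_; _/_)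
open import Data.Nat.DivMod using (m≡m%n+[m/n]*n; m%n<n; %-distribˡ-+)
open import Data.Nat.Divisibility using (_∣_; divides; m%n≡0⇒n∣m; n∣m⇒m%n≡0)
import Data.Nat.Properties as ℕₚ
open import Data.Product using (Σ; _×_; _,_; proj₁; proj₂)
open import Data.Sum using (_⊎_; inj₁; inj₂; [_,_]′)
open import Level using (0ℓ)
open import Relation.Binary.Bundles using (Setoid)
open import Relation.Binary.Structures using (IsEquivalence)
open import Relation.Binary.PropositionalEquality as ≡
  using (_≡_; _≢_; refl; cong; cong₂)
open import Relation.Nullary using (yes; no)
open import Relation.Binary.Definitions using (tri<; tri≈; tri>)
import Relation.Binary.Reasoning.Setoid as SetoidReasoning
import Tactic.RingSolver.Core.AlmostCommutativeRing as ACR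
open import Data.Integer.Tactic.RingSolver using () renaming (solve-∀ to ℤ-solve-∀)
open import Tactic.RingSolver using (solve-∀)
open import Data.Nat.Tactic.RingSolver using () renaming (solve-∀ to ℕ-solve-∀)

weaken< : ∀ {p j} {P : ℕ → Set p} → (∀ k → k < suc j → P k) → ∀ k → k < j → P k
weaken< h k k<j = h k (ℕₚ.m<n⇒m<1+n k<j)

foldUpTo : ∀ {a} {A : Set a} → (A → A → A) → A → ℕ → (ℕ → A) → A
foldUpTo _∙_ ε zero    f = ε
foldUpTo _∙_ ε (suc j) f = foldUpTo _∙_ ε j f ∙ f j

module FiniteSum {a ℓ} (M : CommutativeMonoid a ℓ) where
  open CommutativeMonoid M renaming (refl to ≈-refl; sym to ≈-sym; trans to ≈-trans)
  open CommSemigroupProperties commutativeSemigroup using (interchange)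
  open SetoidReasoning setoid

  ∑< : ℕ → (ℕ → Carrier) → Carrier
  ∑< = foldUpTo _∙_ ε

  syntax ∑< j (λ k → e) = ∑[ k < j ] e

  ∑-cong : ∀ j {f g} → (∀ k → k < j → f k ≈ g k) → ∑< j f ≈ ∑< j g
  ∑-cong zero    _   = ≈-refl
  ∑-cong (suc j) f≈g = ∙-cong (∑-cong j (weaken< f≈g)) (f≈g j ℕₚ.≤-refl)

  ∑-distrib : ∀ j f g → ∑[ k < j ] (f k ∙ g k) ≈ ∑< j f ∙ ∑< j g
  ∑-distrib zero    f g = ≈-sym (identityˡ ε)
  ∑-distrib (suc j) f g = ≈-trans (∙-congʳ (∑-distrib j f g)) (interchange _ _ _ _)

  ∑-zero : ∀ j {f} → (∀ k → k < j → f k ≈ ε) → ∑< j f ≈ ε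
  ∑-zero zero    _   = ≈-refl
  ∑-zero (suc j) f≈ε = ≈-trans (∙-cong (∑-zero j (weaken< f≈ε)) (f≈ε j ℕₚ.≤-refl)) (identityˡ ε)

  ∑-single : ∀ j {f} i → i < j → (∀ k → k < j → k ≢ i → f k ≈ ε) → ∑< j f ≈ f i
  ∑-single (suc j) {f} i i<1+j others with i ℕₚ.≟ j
  ... | yes refl = begin
    ∑< i f ∙ f i ≈⟨ ∙-congʳ (∑-zero i (λ k k<i → weaken< others k k<i (ℕₚ.<⇒≢ k<i))) ⟩
    ε ∙ f i      ≈⟨ identityˡ (f i) ⟩
    f i          ∎
  ... | no i≢j = begin
    ∑< j f ∙ f j ≈⟨ ∙-cong (∑-single j i i<j (weaken< others)) (others j ℕₚ.≤-refl (≡.≢-sym i≢j)) ⟩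
    f i ∙ ε      ≈⟨ identityʳ (f i) ⟩
    f i          ∎
    where i<j = ℕₚ.≤∧≢⇒< (ℕₚ.≤-pred i<1+j) i≢j

  ∑-shift : ∀ j f → ∑< (suc j) f ≈ f 0 ∙ ∑[ k < j ] f (suc k)
  ∑-shift zero    f = comm ε (f 0)
  ∑-shift (suc j) f = ≈-trans (∙-congʳ (∑-shift j f)) (assoc _ _ _)

module _ {a b ℓ₁ ℓ₂} (M : CommutativeMonoid a ℓ₁) (N : CommutativeMonoid b ℓ₂) where
  private
    module M = CommutativeMonoid M
    module N = CommutativeMonoid N
    module ∑M = FiniteSum M
    module ∑N = FiniteSum N

  homo-∑ : (h : M.Carrier → N.Carrier) → h M.ε N.≈ N.ε → (∀ x y → h (x M.∙ y) N.≈ h x N.∙ h y) →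
           ∀ j f → h (∑M.∑< j f) N.≈ ∑N.∑< j (λ k → h (f k))
  homo-∑ h h-ε h-∙ zero    f = h-ε
  homo-∑ h h-ε h-∙ (suc j) f = N.trans (h-∙ _ _) (N.∙-congʳ (homo-∑ h h-ε h-∙ j f))

module Sumℤ = FiniteSum ℤₚ.+-0-commutativeMonoid

∑ℤ : ℕ → (ℕ → ℤ) → ℤ
∑ℤ = foldUpTo ℤ._+_ 0ℤ

infix 5 ∑ℤ
syntax ∑ℤ j (λ k → e) = ∑ℤ[ k < j ] e

nonneg-+≡0 : ∀ {a b} → 0ℤ ℤ.≤ a → 0ℤ ℤ.≤ b → a ℤ.+ b ≡ 0ℤ → a ≡ 0ℤ × b ≡ 0ℤ
nonneg-+≡0 {a} {b} 0≤a 0≤b a+b≡0 =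
  a≡0 , ≡.trans (≡.sym (ℤₚ.+-identityˡ b)) (≡.trans (cong (ℤ._+ b) (≡.sym a≡0)) a+b≡0)
  where
  a≤0 : a ℤ.≤ 0ℤ
  a≤0 = ≡.subst₂ ℤ._≤_ (ℤₚ.+-identityʳ a) a+b≡0 (ℤₚ.+-monoʳ-≤ a 0≤b)
  a≡0 = ℤₚ.≤-antisym a≤0 0≤a

∑ℤ-nonneg : ∀ j {f} → (∀ k → k < j → 0ℤ ℤ.≤ f k) → 0ℤ ℤ.≤ ∑ℤ j f
∑ℤ-nonneg zero    _   = ℤ.+≤+ z≤n
∑ℤ-nonneg (suc j) 0≤f = ℤₚ.+-mono-≤ (∑ℤ-nonneg j (weaken< 0≤f)) (0≤f j ℕₚ.≤-refl)

∑ℤ-nonneg-≡0 : ∀ j {f} → (∀ k → k < j → 0ℤ ℤ.≤ f k) → ∑ℤ j f ≡ 0ℤ →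
               ∀ k → k < j → f k ≡ 0ℤ
∑ℤ-nonneg-≡0 (suc j) 0≤f ∑≡0 k k<1+j
  with nonneg-+≡0 (∑ℤ-nonneg j (weaken< 0≤f)) (0≤f j ℕₚ.≤-refl) ∑≡0 | k ℕₚ.≟ j
... | _     , fj≡0 | yes refl = fj≡0
... | ∑≡0′ , _    | no  k≢j  =
  ∑ℤ-nonneg-≡0 j (weaken< 0≤f) ∑≡0′ k (ℕₚ.≤∧≢⇒< (ℕₚ.≤-pred k<1+j) k≢j)

0≤weighted-square : ∀ s w → 0ℤ ℤ.≤ s ℤ.* (s ℤ.* + suc w)
0≤weighted-square (+ zero)  w = ℤ.+≤+ z≤n
0≤weighted-square (+ suc m) w = ℤ.+≤+ z≤n
0≤weighted-square -[1+ m ]  w = ℤ.+≤+ z≤n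

weighted-square≡0 : ∀ s w → s ℤ.* (s ℤ.* + suc w) ≡ 0ℤ → s ≡ 0ℤ
weighted-square≡0 s w s²w≡0 with ℤₚ.i*j≡0⇒i≡0∨j≡0 s s²w≡0
... | inj₁ s≡0  = s≡0
... | inj₂ sw≡0 with ℤₚ.i*j≡0⇒i≡0∨j≡0 s sw≡0
...   | inj₁ s≡0 = s≡0
...   | inj₂ ()

-- ≈ᴾ unfolds to a Π-type, from which p and q cannot be inferred; the record
-- (and the records _∈_ and _≡[_]_ below) keep them visible to unification.
infix 4 _≃_
record _≃_ (p q : Poly) : Set where
  constructor ⟨_⟩
  field coeff-≡ : p ≈ᴾ q
open _≃_

≃-refl : ∀ {p} → p ≃ p
≃-refl = ⟨ (λ _ → refl) ⟩

≃-sym : ∀ {p q} → p ≃ q → q ≃ p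
≃-sym ⟨ e ⟩ = ⟨ (λ i → ≡.sym (e i)) ⟩

≃-trans : ∀ {p q r} → p ≃ q → q ≃ r → p ≃ r
≃-trans ⟨ e ⟩ ⟨ f ⟩ = ⟨ (λ i → ≡.trans (e i) (f i)) ⟩

≡⇒≃ : ∀ {p q} → p ≡ q → p ≃ q
≡⇒≃ refl = ≃-refl

coeff-+ᴾ : ∀ p q i → coeff (p +ᴾ q) i ≡ coeff p i ℤ.+ coeff q i
coeff-+ᴾ []      q       i       = ≡.sym (ℤₚ.+-identityˡ _)
coeff-+ᴾ (a ∷ p) []      i       = ≡.sym (ℤₚ.+-identityʳ _)
coeff-+ᴾ (a ∷ p) (b ∷ q) zero    = refl
coeff-+ᴾ (a ∷ p) (b ∷ q) (suc i) = coeff-+ᴾ p q i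

coeff-·ᴾ : ∀ c p i → coeff (c ·ᴾ p) i ≡ c ℤ.* coeff p i
coeff-·ᴾ c []      i       = ≡.sym (ℤₚ.*-zeroʳ c)
coeff-·ᴾ c (a ∷ p) zero    = refl
coeff-·ᴾ c (a ∷ p) (suc i) = coeff-·ᴾ c p i

coeff--ᴾ : ∀ p i → coeff (-ᴾ p) i ≡ ℤ.- coeff p i
coeff--ᴾ []      i       = refl
coeff--ᴾ (a ∷ p) zero    = refl
coeff--ᴾ (a ∷ p) (suc i) = coeff--ᴾ p i

∷-cong : ∀ {a b p q} → a ≡ b → p ≃ q → a ∷ p ≃ b ∷ q
∷-cong a≡b ⟨ e ⟩ = ⟨ (λ { zero → a≡b ; (suc i) → e i }) ⟩

∷-injective : ∀ {a b p q} → a ∷ p ≃ b ∷ q → a ≡ b × p ≃ q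
∷-injective ⟨ e ⟩ = e zero , ⟨ (λ i → e (suc i)) ⟩

∷≃[]⁻ : ∀ {a p} → a ∷ p ≃ [] → a ≡ 0ℤ × p ≃ []
∷≃[]⁻ ⟨ e ⟩ = e zero , ⟨ (λ i → e (suc i)) ⟩

∷≃[]⁺ : ∀ {a p} → a ≡ 0ℤ → p ≃ [] → a ∷ p ≃ []
∷≃[]⁺ a≡0 ⟨ e ⟩ = ⟨ (λ { zero → a≡0 ; (suc i) → e i }) ⟩

+ᴾ-cong : ∀ {p p′ q q′} → p ≃ p′ → q ≃ q′ → p +ᴾ q ≃ p′ +ᴾ q′
+ᴾ-cong {p} {p′} {q} {q′} ⟨ e ⟩ ⟨ f ⟩ = ⟨ (λ i →
  ≡.trans (coeff-+ᴾ p q i) (≡.trans (cong₂ ℤ._+_ (e i) (f i)) (≡.sym (coeff-+ᴾ p′ q′ i)))) ⟩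

+ᴾ-congˡ : ∀ p {q q′} → q ≃ q′ → p +ᴾ q ≃ p +ᴾ q′
+ᴾ-congˡ p = +ᴾ-cong ≃-refl

+ᴾ-congʳ : ∀ {p p′} q → p ≃ p′ → p +ᴾ q ≃ p′ +ᴾ q
+ᴾ-congʳ q p≃p′ = +ᴾ-cong p≃p′ ≃-refl

·ᴾ-cong : ∀ c {p q} → p ≃ q → c ·ᴾ p ≃ c ·ᴾ q
·ᴾ-cong c {p} {q} ⟨ e ⟩ = ⟨ (λ i →
  ≡.trans (coeff-·ᴾ c p i) (≡.trans (cong (c ℤ.*_) (e i)) (≡.sym (coeff-·ᴾ c q i)))) ⟩

-ᴾ-cong : ∀ {p q} → p ≃ q → -ᴾ p ≃ -ᴾ q
-ᴾ-cong {p} {q} ⟨ e ⟩ = ⟨ (λ i →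
  ≡.trans (coeff--ᴾ p i) (≡.trans (cong ℤ.-_ (e i)) (≡.sym (coeff--ᴾ q i)))) ⟩

+ᴾ-comm : ∀ p q → p +ᴾ q ≃ q +ᴾ p
+ᴾ-comm p q = ⟨ (λ i →
  ≡.trans (coeff-+ᴾ p q i) (≡.trans (ℤₚ.+-comm (coeff p i) _) (≡.sym (coeff-+ᴾ q p i)))) ⟩

+ᴾ-assoc : ∀ p q r → (p +ᴾ q) +ᴾ r ≃ p +ᴾ (q +ᴾ r)
+ᴾ-assoc p q r = ⟨ (λ i → begin
  coeff ((p +ᴾ q) +ᴾ r) i                        ≡⟨ coeff-+ᴾ (p +ᴾ q) r i ⟩
  coeff (p +ᴾ q) i ℤ.+ coeff r i                 ≡⟨ cong (ℤ._+ coeff r i) (coeff-+ᴾ p q i) ⟩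
  (coeff p i ℤ.+ coeff q i) ℤ.+ coeff r i        ≡⟨ ℤₚ.+-assoc (coeff p i) _ _ ⟩
  coeff p i ℤ.+ (coeff q i ℤ.+ coeff r i)        ≡⟨ cong (λ x → coeff p i ℤ.+ x) (coeff-+ᴾ q r i) ⟨
  coeff p i ℤ.+ coeff (q +ᴾ r) i                 ≡⟨ coeff-+ᴾ p (q +ᴾ r) i ⟨
  coeff (p +ᴾ (q +ᴾ r)) i                        ∎) ⟩
  where open ≡.≡-Reasoning

+ᴾ-identityʳ : ∀ p → p +ᴾ [] ≃ p
+ᴾ-identityʳ p = ⟨ (λ i → ≡.trans (coeff-+ᴾ p [] i) (ℤₚ.+-identityʳ _)) ⟩

+ᴾ-inverseʳ : ∀ p → p -ᴾ p ≃ []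
+ᴾ-inverseʳ p = ⟨ (λ i → ≡.trans (coeff-+ᴾ p (-ᴾ p) i)
                  (≡.trans (cong (λ x → coeff p i ℤ.+ x) (coeff--ᴾ p i)) (ℤₚ.+-inverseʳ (coeff p i)))) ⟩

·ᴾ-zeroˡ : ∀ p → 0ℤ ·ᴾ p ≃ []
·ᴾ-zeroˡ p = ⟨ (λ i → coeff-·ᴾ 0ℤ p i) ⟩

·ᴾ-identityˡ : ∀ p → + 1 ·ᴾ p ≃ p
·ᴾ-identityˡ p = ⟨ (λ i → ≡.trans (coeff-·ᴾ (+ 1) p i) (ℤₚ.*-identityˡ _)) ⟩

·ᴾ-distribˡ : ∀ c p q → c ·ᴾ (p +ᴾ q) ≃ c ·ᴾ p +ᴾ c ·ᴾ q
·ᴾ-distribˡ c p q = ⟨ (λ i → begin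
  coeff (c ·ᴾ (p +ᴾ q)) i                        ≡⟨ coeff-·ᴾ c (p +ᴾ q) i ⟩
  c ℤ.* coeff (p +ᴾ q) i                         ≡⟨ cong (c ℤ.*_) (coeff-+ᴾ p q i) ⟩
  c ℤ.* (coeff p i ℤ.+ coeff q i)                ≡⟨ ℤₚ.*-distribˡ-+ c _ _ ⟩
  c ℤ.* coeff p i ℤ.+ c ℤ.* coeff q i            ≡⟨ cong₂ ℤ._+_ (coeff-·ᴾ c p i) (coeff-·ᴾ c q i) ⟨
  coeff (c ·ᴾ p) i ℤ.+ coeff (c ·ᴾ q) i          ≡⟨ coeff-+ᴾ (c ·ᴾ p) (c ·ᴾ q) i ⟨
  coeff (c ·ᴾ p +ᴾ c ·ᴾ q) i                     ∎) ⟩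
  where open ≡.≡-Reasoning

·ᴾ-distribʳ : ∀ c d p → (c ℤ.+ d) ·ᴾ p ≃ c ·ᴾ p +ᴾ d ·ᴾ p
·ᴾ-distribʳ c d p = ⟨ (λ i → begin
  coeff ((c ℤ.+ d) ·ᴾ p) i                       ≡⟨ coeff-·ᴾ (c ℤ.+ d) p i ⟩
  (c ℤ.+ d) ℤ.* coeff p i                        ≡⟨ ℤₚ.*-distribʳ-+ (coeff p i) c d ⟩
  c ℤ.* coeff p i ℤ.+ d ℤ.* coeff p i            ≡⟨ cong₂ ℤ._+_ (coeff-·ᴾ c p i) (coeff-·ᴾ d p i) ⟨
  coeff (c ·ᴾ p) i ℤ.+ coeff (d ·ᴾ p) i          ≡⟨ coeff-+ᴾ (c ·ᴾ p) (d ·ᴾ p) i ⟨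
  coeff (c ·ᴾ p +ᴾ d ·ᴾ p) i                     ∎) ⟩
  where open ≡.≡-Reasoning

·ᴾ-assoc : ∀ c d p → c ·ᴾ (d ·ᴾ p) ≃ (c ℤ.* d) ·ᴾ p
·ᴾ-assoc c d p = ⟨ (λ i → begin
  coeff (c ·ᴾ (d ·ᴾ p)) i                        ≡⟨ coeff-·ᴾ c (d ·ᴾ p) i ⟩
  c ℤ.* coeff (d ·ᴾ p) i                         ≡⟨ cong (c ℤ.*_) (coeff-·ᴾ d p i) ⟩
  c ℤ.* (d ℤ.* coeff p i)                        ≡⟨ ℤₚ.*-assoc c d _ ⟨
  (c ℤ.* d) ℤ.* coeff p i                        ≡⟨ coeff-·ᴾ (c ℤ.* d) p i ⟨
  coeff ((c ℤ.* d) ·ᴾ p) i                       ∎) ⟩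
  where open ≡.≡-Reasoning

-ᴾ≃-1·ᴾ : ∀ p → -ᴾ p ≃ ℤ.-1ℤ ·ᴾ p
-ᴾ≃-1·ᴾ p = ⟨ (λ i →
  ≡.trans (coeff--ᴾ p i) (≡.trans (≡.sym (ℤₚ.-1*i≡-i _)) (≡.sym (coeff-·ᴾ ℤ.-1ℤ p i)))) ⟩

interchangeᴾ : ∀ w x y z → (w +ᴾ x) +ᴾ (y +ᴾ z) ≃ (w +ᴾ y) +ᴾ (x +ᴾ z)
interchangeᴾ w x y z = ⟨ (λ i → begin
  coeff ((w +ᴾ x) +ᴾ (y +ᴾ z)) i
    ≡⟨ ≡.trans (coeff-+ᴾ (w +ᴾ x) _ i) (cong₂ ℤ._+_ (coeff-+ᴾ w x i) (coeff-+ᴾ y z i)) ⟩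
  (coeff w i ℤ.+ coeff x i) ℤ.+ (coeff y i ℤ.+ coeff z i)
    ≡⟨ ℤ-interchange (coeff w i) _ _ _ ⟩
  (coeff w i ℤ.+ coeff y i) ℤ.+ (coeff x i ℤ.+ coeff z i)
    ≡⟨ ≡.trans (coeff-+ᴾ (w +ᴾ y) _ i) (cong₂ ℤ._+_ (coeff-+ᴾ w y i) (coeff-+ᴾ x z i)) ⟨
  coeff ((w +ᴾ y) +ᴾ (x +ᴾ z)) i ∎) ⟩
  where
  open ≡.≡-Reasoning
  ℤ-interchange : ∀ a b c d → (a ℤ.+ b) ℤ.+ (c ℤ.+ d) ≡ (a ℤ.+ c) ℤ.+ (b ℤ.+ d)
  ℤ-interchange = ℤ-solve-∀

*ᴾ-zeroʳ : ∀ p → p *ᴾ [] ≃ []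
*ᴾ-zeroʳ []      = ≃-refl
*ᴾ-zeroʳ (a ∷ p) = ∷≃[]⁺ refl (*ᴾ-zeroʳ p)

*ᴾ-zeroˡ : ∀ {p} q → p ≃ [] → p *ᴾ q ≃ []
*ᴾ-zeroˡ {[]}    q _    = ≃-refl
*ᴾ-zeroˡ {a ∷ p} q p≃0 with ∷≃[]⁻ p≃0
... | refl , p≃[] = +ᴾ-cong (·ᴾ-zeroˡ q) (∷≃[]⁺ refl (*ᴾ-zeroˡ q p≃[]))

*ᴾ-congʳ : ∀ {p p′} q → p ≃ p′ → p *ᴾ q ≃ p′ *ᴾ q
*ᴾ-congʳ {[]}    {p′}     q e = ≃-sym (*ᴾ-zeroˡ q (≃-sym e))
*ᴾ-congʳ {a ∷ p} {[]}     q e = *ᴾ-zeroˡ q e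
*ᴾ-congʳ {a ∷ p} {b ∷ p′} q e with ∷-injective e
... | refl , p≃p′ = +ᴾ-congˡ (a ·ᴾ q) (∷-cong refl (*ᴾ-congʳ q p≃p′))

*ᴾ-congˡ : ∀ p {q q′} → q ≃ q′ → p *ᴾ q ≃ p *ᴾ q′
*ᴾ-congˡ []      e = ≃-refl
*ᴾ-congˡ (a ∷ p) e = +ᴾ-cong (·ᴾ-cong a e) (∷-cong refl (*ᴾ-congˡ p e))

*ᴾ-cong : ∀ {p p′ q q′} → p ≃ p′ → q ≃ q′ → p *ᴾ q ≃ p′ *ᴾ q′
*ᴾ-cong {p′ = p′} {q = q} e f = ≃-trans (*ᴾ-congʳ q e) (*ᴾ-congˡ p′ f)

*ᴾ-distribʳ : ∀ r p q → (p +ᴾ q) *ᴾ r ≃ p *ᴾ r +ᴾ q *ᴾ r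
*ᴾ-distribʳ r []      q       = ≃-refl
*ᴾ-distribʳ r (a ∷ p) []      = ≃-sym (+ᴾ-identityʳ _)
*ᴾ-distribʳ r (a ∷ p) (b ∷ q) =
  ≃-trans (+ᴾ-cong (·ᴾ-distribʳ a b r) (∷-cong refl (*ᴾ-distribʳ r p q)))
          (interchangeᴾ (a ·ᴾ r) (b ·ᴾ r) _ _)

*ᴾ-distribˡ : ∀ p q r → p *ᴾ (q +ᴾ r) ≃ p *ᴾ q +ᴾ p *ᴾ r
*ᴾ-distribˡ []      q r = ≃-refl
*ᴾ-distribˡ (a ∷ p) q r =
  ≃-trans (+ᴾ-cong (·ᴾ-distribˡ a q r) (∷-cong refl (*ᴾ-distribˡ p q r)))
          (interchangeᴾ (a ·ᴾ q) (a ·ᴾ r) _ _)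

·ᴾ-*ᴾ-assoc : ∀ c p q → (c ·ᴾ p) *ᴾ q ≃ c ·ᴾ (p *ᴾ q)
·ᴾ-*ᴾ-assoc c []      q = ≃-refl
·ᴾ-*ᴾ-assoc c (a ∷ p) q =
  ≃-trans (+ᴾ-cong (≃-sym (·ᴾ-assoc c a q)) (∷-cong (≡.sym (ℤₚ.*-zeroʳ c)) (·ᴾ-*ᴾ-assoc c p q)))
          (≃-sym (·ᴾ-distribˡ c (a ·ᴾ q) (0ℤ ∷ (p *ᴾ q))))

*ᴾ-·ᴾ-comm : ∀ c p q → p *ᴾ (c ·ᴾ q) ≃ c ·ᴾ (p *ᴾ q)
*ᴾ-·ᴾ-comm c []      q = ≃-refl
*ᴾ-·ᴾ-comm c (a ∷ p) q =
  ≃-trans (+ᴾ-cong (≃-trans (·ᴾ-assoc a c q) (≃-trans ac≃ca (≃-sym (·ᴾ-assoc c a q))))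
                   (∷-cong (≡.sym (ℤₚ.*-zeroʳ c)) (*ᴾ-·ᴾ-comm c p q)))
          (≃-sym (·ᴾ-distribˡ c (a ·ᴾ q) (0ℤ ∷ (p *ᴾ q))))
  where ac≃ca = ≡⇒≃ (cong (_·ᴾ q) (ℤₚ.*-comm a c))

*ᴾ-assoc : ∀ p q r → (p *ᴾ q) *ᴾ r ≃ p *ᴾ (q *ᴾ r)
*ᴾ-assoc []      q r = ≃-refl
*ᴾ-assoc (a ∷ p) q r =
  ≃-trans (*ᴾ-distribʳ r (a ·ᴾ q) _)
          (+ᴾ-cong (·ᴾ-*ᴾ-assoc a q r)
                   (≃-trans (+ᴾ-congʳ _ (·ᴾ-zeroˡ r)) (∷-cong refl (*ᴾ-assoc p q r))))

*ᴾ-∷ : ∀ p b q → p *ᴾ (b ∷ q) ≃ b ·ᴾ p +ᴾ (0ℤ ∷ (p *ᴾ q))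
*ᴾ-∷ []      b q = ≃-sym (∷≃[]⁺ refl ≃-refl)
*ᴾ-∷ (a ∷ p) b q = ⟨ (λ where
  zero    → ≡.trans (ℤₚ.+-identityʳ _) (≡.trans (ℤₚ.*-comm a b) (≡.sym (ℤₚ.+-identityʳ _)))
  (suc i) → begin
    coeff (a ·ᴾ q +ᴾ p *ᴾ (b ∷ q)) i               ≡⟨ coeff-≡ (+ᴾ-comm (a ·ᴾ q) _) i ⟩
    coeff (p *ᴾ (b ∷ q) +ᴾ a ·ᴾ q) i               ≡⟨ coeff-≡ (+ᴾ-congʳ (a ·ᴾ q) (*ᴾ-∷ p b q)) i ⟩
    coeff ((b ·ᴾ p +ᴾ (0ℤ ∷ p *ᴾ q)) +ᴾ a ·ᴾ q) i  ≡⟨ coeff-≡ (swap (b ·ᴾ p) _ _) i ⟩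
    coeff (b ·ᴾ p +ᴾ (a ·ᴾ q +ᴾ (0ℤ ∷ p *ᴾ q))) i  ∎) ⟩
  where
  open ≡.≡-Reasoning
  swap : ∀ u v w → (u +ᴾ v) +ᴾ w ≃ u +ᴾ (w +ᴾ v)
  swap u v w = ≃-trans (+ᴾ-assoc u v w) (+ᴾ-congˡ u (+ᴾ-comm v w))

*ᴾ-comm : ∀ p q → p *ᴾ q ≃ q *ᴾ p
*ᴾ-comm []      q = ≃-sym (*ᴾ-zeroʳ q)
*ᴾ-comm (a ∷ p) q = ≃-trans (+ᴾ-congˡ (a ·ᴾ q) (∷-cong refl (*ᴾ-comm p q))) (≃-sym (*ᴾ-∷ q a p))

1ᴾ : Poly
1ᴾ = constᴾ (+ 1)

constᴾ-*ᴾ : ∀ c p → constᴾ c *ᴾ p ≃ c ·ᴾ p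
constᴾ-*ᴾ c p = ≃-trans (+ᴾ-congˡ (c ·ᴾ p) (∷≃[]⁺ refl ≃-refl)) (+ᴾ-identityʳ (c ·ᴾ p))

*ᴾ-identityˡ : ∀ p → 1ᴾ *ᴾ p ≃ p
*ᴾ-identityˡ p = ≃-trans (constᴾ-*ᴾ (+ 1) p) (·ᴾ-identityˡ p)

ℤ[t] : CommutativeRing 0ℓ 0ℓ
ℤ[t] = record
  { Carrier = Poly ; _≈_ = _≃_ ; _+_ = _+ᴾ_ ; _*_ = _*ᴾ_ ; -_ = -ᴾ_ ; 0# = [] ; 1# = 1ᴾ
  ; isCommutativeRing = record
    { isRing = record
      { +-isAbelianGroup = record
        { isGroup = record
          { isMonoid = record
            { isSemigroup = record
              { isMagma = record
                { isEquivalence = record { refl = ≃-refl ; sym = ≃-sym ; trans = ≃-trans }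
                ; ∙-cong = +ᴾ-cong }
              ; assoc = +ᴾ-assoc }
            ; identity = (λ _ → ≃-refl) , +ᴾ-identityʳ }
          ; inverse = (λ p → ≃-trans (+ᴾ-comm (-ᴾ p) p) (+ᴾ-inverseʳ p)) , +ᴾ-inverseʳ
          ; ⁻¹-cong = -ᴾ-cong }
        ; comm = +ᴾ-comm }
      ; *-cong = *ᴾ-cong
      ; *-assoc = *ᴾ-assoc
      ; *-identity = *ᴾ-identityˡ , (λ p → ≃-trans (*ᴾ-comm p _) (*ᴾ-identityˡ p))
      ; distrib = *ᴾ-distribˡ , *ᴾ-distribʳ }
    ; *-comm = *ᴾ-comm } }

≟[] : ∀ p → Maybe ([] ≃ p)
≟[] []      = just ≃-refl
≟[] (a ∷ p) with a ℤ.≟ 0ℤ | ≟[] p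
... | yes a≡0 | just []≃p = just (≃-sym (∷≃[]⁺ a≡0 (≃-sym []≃p)))
... | _       | _         = nothing

ℤ[t]ᴬ : ACR.AlmostCommutativeRing 0ℓ 0ℓ
ℤ[t]ᴬ = ACR.fromCommutativeRing ℤ[t] ≟[]

module ≃-Reasoning = SetoidReasoning (CommutativeRing.setoid ℤ[t])

ℤ[t]⁺ : CommutativeMonoid 0ℓ 0ℓ
ℤ[t]⁺ = CommutativeRing.+-commutativeMonoid ℤ[t]

module Sumᴾ = FiniteSum ℤ[t]⁺

∑ᴾ : ℕ → (ℕ → Poly) → Poly
∑ᴾ = foldUpTo _+ᴾ_ []

infix 5 ∑ᴾ
syntax ∑ᴾ j (λ k → e) = ∑ᴾ[ k < j ] e

sumᴾ-applyUpTo : ∀ (F : ℕ → Poly) (f : ℕ → ℕ) j →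
                 sumᴾ (map F (applyUpTo f j)) ≃ ∑ᴾ[ k < j ] F (f k)
sumᴾ-applyUpTo F f zero    = ≃-refl
sumᴾ-applyUpTo F f (suc j) =
  ≃-trans (+ᴾ-congˡ (F (f 0)) (sumᴾ-applyUpTo F (λ k → f (suc k)) j))
          (≃-sym (Sumᴾ.∑-shift j (λ k → F (f k))))

·ᴾ-1ᴾ : ∀ c → c ·ᴾ 1ᴾ ≃ constᴾ c
·ᴾ-1ᴾ c = ∷-cong (ℤₚ.*-identityʳ c) ≃-refl

*ᴾ-identityʳ : ∀ p → p *ᴾ 1ᴾ ≃ p
*ᴾ-identityʳ p = ≃-trans (*ᴾ-comm p 1ᴾ) (*ᴾ-identityˡ p)

X*ᴾ : ∀ p → X *ᴾ p ≃ 0ℤ ∷ p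
X*ᴾ p = +ᴾ-cong (·ᴾ-zeroˡ p) (∷-cong refl (*ᴾ-identityˡ p))

^ᴾ-+ : ∀ p a b → p ^ᴾ (a + b) ≃ p ^ᴾ a *ᴾ p ^ᴾ b
^ᴾ-+ p zero    b = ≃-sym (*ᴾ-identityˡ _)
^ᴾ-+ p (suc a) b = ≃-trans (*ᴾ-congˡ p (^ᴾ-+ p a b)) (≃-sym (*ᴾ-assoc p _ _))

^ᴾ-* : ∀ p a b → p ^ᴾ (a * b) ≃ (p ^ᴾ a) ^ᴾ b
^ᴾ-* p a zero    rewrite ℕₚ.*-zeroʳ a = ≃-refl
^ᴾ-* p a (suc b) rewrite ℕₚ.*-suc a b = ≃-trans (^ᴾ-+ p a (a * b)) (*ᴾ-congˡ (p ^ᴾ a) (^ᴾ-* p a b))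

^ᴾ-cong : ∀ {p q} k → p ≃ q → p ^ᴾ k ≃ q ^ᴾ k
^ᴾ-cong zero    _   = ≃-refl
^ᴾ-cong (suc k) p≃q = *ᴾ-cong p≃q (^ᴾ-cong k p≃q)

^ᴾ-*ᴾ-distrib : ∀ p q k → (p *ᴾ q) ^ᴾ k ≃ p ^ᴾ k *ᴾ q ^ᴾ k
^ᴾ-*ᴾ-distrib p q zero    = ≃-sym (*ᴾ-identityˡ 1ᴾ)
^ᴾ-*ᴾ-distrib p q (suc k) =
  ≃-trans (*ᴾ-congˡ (p *ᴾ q) (^ᴾ-*ᴾ-distrib p q k)) (middle-swap p q (p ^ᴾ k) (q ^ᴾ k))
  where
  middle-swap : ∀ p q a b → (p *ᴾ q) *ᴾ (a *ᴾ b) ≃ (p *ᴾ a) *ᴾ (q *ᴾ b)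
  middle-swap = solve-∀ ℤ[t]ᴬ

∘ᴾ-≃[] : ∀ {p} q → p ≃ [] → p ∘ᴾ q ≃ []
∘ᴾ-≃[] {[]}    q _   = ≃-refl
∘ᴾ-≃[] {a ∷ p} q p≃0 with ∷≃[]⁻ p≃0
... | refl , p≃[] =
  +ᴾ-cong (∷≃[]⁺ refl ≃-refl) (≃-trans (*ᴾ-congˡ q (∘ᴾ-≃[] q p≃[])) (*ᴾ-zeroʳ q))

∘ᴾ-congʳ : ∀ {p p′} q → p ≃ p′ → p ∘ᴾ q ≃ p′ ∘ᴾ q
∘ᴾ-congʳ {[]}    {p′}     q e = ≃-sym (∘ᴾ-≃[] q (≃-sym e))
∘ᴾ-congʳ {a ∷ p} {[]}     q e = ∘ᴾ-≃[] q e
∘ᴾ-congʳ {a ∷ p} {b ∷ p′} q e with ∷-injective e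
... | refl , p≃p′ = +ᴾ-congˡ (constᴾ a) (*ᴾ-congˡ q (∘ᴾ-congʳ q p≃p′))

∘ᴾ-+ : ∀ p p′ q → (p +ᴾ p′) ∘ᴾ q ≃ p ∘ᴾ q +ᴾ p′ ∘ᴾ q
∘ᴾ-+ []      p′       q = ≃-refl
∘ᴾ-+ (a ∷ p) []       q = ≃-sym (+ᴾ-identityʳ _)
∘ᴾ-+ (a ∷ p) (b ∷ p′) q =
  ≃-trans (+ᴾ-congˡ (constᴾ (a ℤ.+ b)) (*ᴾ-congˡ q (∘ᴾ-+ p p′ q)))
          (regroup (constᴾ a) (constᴾ b) q (p ∘ᴾ q) (p′ ∘ᴾ q))
  where
  regroup : ∀ a b q r s → (a +ᴾ b) +ᴾ q *ᴾ (r +ᴾ s) ≃ (a +ᴾ q *ᴾ r) +ᴾ (b +ᴾ q *ᴾ s)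
  regroup = solve-∀ ℤ[t]ᴬ

∘ᴾ-· : ∀ c p q → (c ·ᴾ p) ∘ᴾ q ≃ c ·ᴾ (p ∘ᴾ q)
∘ᴾ-· c []      q = ≃-refl
∘ᴾ-· c (a ∷ p) q =
  ≃-trans (+ᴾ-congˡ (constᴾ (c ℤ.* a)) (≃-trans (*ᴾ-congˡ q (∘ᴾ-· c p q)) (*ᴾ-·ᴾ-comm c q _)))
          (≃-sym (·ᴾ-distribˡ c (constᴾ a) (q *ᴾ (p ∘ᴾ q))))

∘ᴾ-- : ∀ p p′ q → (p -ᴾ p′) ∘ᴾ q ≃ p ∘ᴾ q -ᴾ p′ ∘ᴾ q
∘ᴾ-- p p′ q = ≃-trans (∘ᴾ-+ p (-ᴾ p′) q) (+ᴾ-congˡ (p ∘ᴾ q) neg)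
  where
  neg = begin
    (-ᴾ p′) ∘ᴾ q          ≈⟨ ∘ᴾ-congʳ q (-ᴾ≃-1·ᴾ p′) ⟩
    (ℤ.-1ℤ ·ᴾ p′) ∘ᴾ q    ≈⟨ ∘ᴾ-· ℤ.-1ℤ p′ q ⟩
    ℤ.-1ℤ ·ᴾ (p′ ∘ᴾ q)    ≈⟨ -ᴾ≃-1·ᴾ (p′ ∘ᴾ q) ⟨
    -ᴾ (p′ ∘ᴾ q)          ∎
    where open ≃-Reasoning

∘ᴾ-const : ∀ a q → constᴾ a ∘ᴾ q ≃ constᴾ a
∘ᴾ-const a q = ≃-trans (+ᴾ-congˡ (constᴾ a) (*ᴾ-zeroʳ q)) (+ᴾ-identityʳ _)

∘ᴾ-* : ∀ p p′ q → (p *ᴾ p′) ∘ᴾ q ≃ p ∘ᴾ q *ᴾ p′ ∘ᴾ q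
∘ᴾ-* []      p′ q = ≃-refl
∘ᴾ-* (a ∷ p) p′ q = begin
  (a ·ᴾ p′ +ᴾ (0ℤ ∷ p *ᴾ p′)) ∘ᴾ q
    ≈⟨ ∘ᴾ-+ (a ·ᴾ p′) _ q ⟩
  (a ·ᴾ p′) ∘ᴾ q +ᴾ (0ℤ ∷ p *ᴾ p′) ∘ᴾ q
    ≈⟨ +ᴾ-cong (∘ᴾ-· a p′ q) (+ᴾ-congʳ _ (∷≃[]⁺ refl ≃-refl)) ⟩
  a ·ᴾ (p′ ∘ᴾ q) +ᴾ q *ᴾ ((p *ᴾ p′) ∘ᴾ q)
    ≈⟨ +ᴾ-cong (≃-sym (constᴾ-*ᴾ a _)) (*ᴾ-congˡ q (∘ᴾ-* p p′ q)) ⟩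
  constᴾ a *ᴾ p′ ∘ᴾ q +ᴾ q *ᴾ (p ∘ᴾ q *ᴾ p′ ∘ᴾ q)
    ≈⟨ factor (constᴾ a) q (p ∘ᴾ q) (p′ ∘ᴾ q) ⟩
  (constᴾ a +ᴾ q *ᴾ (p ∘ᴾ q)) *ᴾ p′ ∘ᴾ q ∎
  where
  open ≃-Reasoning
  factor : ∀ a q r s → a *ᴾ s +ᴾ q *ᴾ (r *ᴾ s) ≃ (a +ᴾ q *ᴾ r) *ᴾ s
  factor = solve-∀ ℤ[t]ᴬ

∘ᴾ-X : ∀ q → X ∘ᴾ q ≃ q
∘ᴾ-X q = begin
  constᴾ 0ℤ +ᴾ q *ᴾ (1ᴾ ∘ᴾ q)   ≈⟨ +ᴾ-congʳ _ (∷≃[]⁺ refl ≃-refl) ⟩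
  q *ᴾ (1ᴾ ∘ᴾ q)               ≈⟨ *ᴾ-congˡ q (∘ᴾ-const (+ 1) q) ⟩
  q *ᴾ 1ᴾ                      ≈⟨ *ᴾ-identityʳ q ⟩
  q                            ∎
  where open ≃-Reasoning

∘ᴾ-^ : ∀ p k q → (p ^ᴾ k) ∘ᴾ q ≃ (p ∘ᴾ q) ^ᴾ k
∘ᴾ-^ p zero    q = ∘ᴾ-const (+ 1) q
∘ᴾ-^ p (suc k) q = ≃-trans (∘ᴾ-* p (p ^ᴾ k) q) (*ᴾ-congˡ (p ∘ᴾ q) (∘ᴾ-^ p k q))

∘ᴾ-assoc : ∀ p q r → (p ∘ᴾ q) ∘ᴾ r ≃ p ∘ᴾ (q ∘ᴾ r)
∘ᴾ-assoc []      q r = ≃-refl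
∘ᴾ-assoc (a ∷ p) q r =
  ≃-trans (∘ᴾ-+ (constᴾ a) (q *ᴾ (p ∘ᴾ q)) r)
          (+ᴾ-cong (∘ᴾ-const a r)
                   (≃-trans (∘ᴾ-* q (p ∘ᴾ q) r) (*ᴾ-congˡ (q ∘ᴾ r) (∘ᴾ-assoc p q r))))

infix 4 _∈_ _≡[_]_

record _∈_ (f : Poly) (G : Poly → Set) : Set where
  constructor mem
  field unmem : f ∈⟨ G ⟩
open _∈_

record _≡[_]_ (p : Poly) (G : Poly → Set) (q : Poly) : Set where
  constructor ≡-by
  field difference∈ : p -ᴾ q ∈ G
open _≡[_]_

≈ᴾ⇒≃ : ∀ p q → p ≈ᴾ q → p ≃ q
≈ᴾ⇒≃ _ _ = ⟨_⟩

combination : List (Poly × Poly) → Poly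
combination cs = sumᴾ (map (λ c → proj₁ c *ᴾ proj₂ c) cs)

module _ {G : Poly → Set} where

  ∈-resp-≃ : ∀ {f f′} → f ≃ f′ → f ∈ G → f′ ∈ G
  ∈-resp-≃ {f} f≃f′ (mem (cs , gens , f≈)) =
    mem (cs , gens , coeff-≡ (≃-trans (≃-sym f≃f′) (≈ᴾ⇒≃ f (combination cs) f≈)))

  ∈-≃[] : ∀ {f} → f ≃ [] → f ∈ G
  ∈-≃[] f≃[] = mem ([] , [] , coeff-≡ f≃[])

  generator∈ : ∀ {g} → G g → g ∈ G
  generator∈ {g} Gg =
    mem ((1ᴾ , g) ∷ [] , Gg ∷ [] , coeff-≡ (≃-sym (≃-trans (+ᴾ-identityʳ _) (*ᴾ-identityˡ g))))

  ∈-+ : ∀ {f g} → f ∈ G → g ∈ G → f +ᴾ g ∈ G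
  ∈-+ {f} {g} (mem (cs , gs , f≈)) (mem (ds , hs , g≈)) =
    mem (cs ++ ds , All.++⁺ gs hs , coeff-≡ f+g≃)
    where
    sum-++ : ∀ cs ds → combination (cs ++ ds) ≃ combination cs +ᴾ combination ds
    sum-++ []       ds = ≃-refl
    sum-++ (c ∷ cs) ds = ≃-trans (+ᴾ-congˡ _ (sum-++ cs ds)) (≃-sym (+ᴾ-assoc (proj₁ c *ᴾ proj₂ c) _ _))
    f+g≃ : f +ᴾ g ≃ combination (cs ++ ds)
    f+g≃ = ≃-trans (+ᴾ-cong (≈ᴾ⇒≃ f (combination cs) f≈) (≈ᴾ⇒≃ g (combination ds) g≈))
                   (≃-sym (sum-++ cs ds))

  ∈-* : ∀ h {f} → f ∈ G → h *ᴾ f ∈ G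
  ∈-* h {f} (mem (cs , gs , f≈)) =
    mem (map (λ c → h *ᴾ proj₁ c , proj₂ c) cs , All.map⁺ gs ,
         coeff-≡ (≃-trans (*ᴾ-congˡ h (≈ᴾ⇒≃ f (combination cs) f≈)) (≃-sym (sum-scaled cs))))
    where
    sum-scaled : ∀ cs → combination (map (λ c → h *ᴾ proj₁ c , proj₂ c) cs) ≃ h *ᴾ combination cs
    sum-scaled []       = ≃-sym (*ᴾ-zeroʳ h)
    sum-scaled (c ∷ cs) =
      ≃-trans (+ᴾ-cong (*ᴾ-assoc h _ _) (sum-scaled cs)) (≃-sym (*ᴾ-distribˡ h _ _))

  ∈-· : ∀ c {f} → f ∈ G → c ·ᴾ f ∈ G
  ∈-· c {f} f∈ = ∈-resp-≃ (constᴾ-*ᴾ c f) (∈-* (constᴾ c) f∈)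

  ∈--ᴾ : ∀ {f} → f ∈ G → -ᴾ f ∈ G
  ∈--ᴾ {f} f∈ = ∈-resp-≃ (≃-sym (-ᴾ≃-1·ᴾ f)) (∈-· ℤ.-1ℤ f∈)

  ∈-induction : (P : Poly → Set) → (∀ {f f′} → f ≃ f′ → P f → P f′) →
                P [] → (∀ {f g} → P f → P g → P (f +ᴾ g)) → (∀ h {g} → G g → P (h *ᴾ g)) →
                ∀ {f} → f ∈ G → P f
  ∈-induction P resp P[] P+ P* {f} (mem (cs , gs , f≈)) =
    resp (≃-sym (≈ᴾ⇒≃ f (combination cs) f≈)) (go cs gs)
    where
    go : ∀ cs → All (λ c → G (proj₂ c)) cs → P (combination cs)
    go []             []       = P[]
    go ((h , g) ∷ cs) (Gg ∷ gs) = P+ (P* h Gg) (go cs gs)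

∈-mono : ∀ {G H} → (∀ {g} → G g → g ∈ H) → ∀ {f} → f ∈ G → f ∈ H
∈-mono G⊆H = ∈-induction (_∈ _) ∈-resp-≃ (∈-≃[] ≃-refl) ∈-+ (λ h Gg → ∈-* h (G⊆H Gg))

∈-principal : ∀ {d f} → f ∈ (_≈ᴾ d) → Σ Poly λ q → f ≃ q *ᴾ d
∈-principal {d} = ∈-induction (λ f → Σ Poly λ q → f ≃ q *ᴾ d)
  (λ f≃f′ (q , f≃qd) → q , ≃-trans (≃-sym f≃f′) f≃qd)
  ([] , ≃-refl)
  (λ (q , f≃qd) (r , g≃rd) → q +ᴾ r , ≃-trans (+ᴾ-cong f≃qd g≃rd) (≃-sym (*ᴾ-distribʳ d q r)))
  (λ h g≈d → h , *ᴾ-congˡ h ⟨ g≈d ⟩)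

∘ᴾ-∈ : ∀ {G H} t → (∀ {g} → G g → g ∘ᴾ t ∈ H) → ∀ {f} → f ∈ G → f ∘ᴾ t ∈ H
∘ᴾ-∈ t G∘t⊆H = ∈-induction (λ f → f ∘ᴾ t ∈ _)
  (λ f≃f′ → ∈-resp-≃ (∘ᴾ-congʳ t f≃f′))
  (∈-≃[] ≃-refl)
  (λ {f} {g} f∘t∈ g∘t∈ → ∈-resp-≃ (≃-sym (∘ᴾ-+ f g t)) (∈-+ f∘t∈ g∘t∈))
  (λ h {g} Gg → ∈-resp-≃ (≃-sym (∘ᴾ-* h g t)) (∈-* (h ∘ᴾ t) (G∘t⊆H Gg)))

module _ {G : Poly → Set} where

  ≃⇒≡ : ∀ {p q} → p ≃ q → p ≡[ G ] q
  ≃⇒≡ {p} p≃q = ≡-by (∈-≃[] (≃-trans (+ᴾ-congˡ p (-ᴾ-cong (≃-sym p≃q))) (+ᴾ-inverseʳ p)))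

  ≡-sym : ∀ {p q} → p ≡[ G ] q → q ≡[ G ] p
  ≡-sym {p} {q} (≡-by p-q∈) = ≡-by (∈-resp-≃ (flip p q) (∈--ᴾ p-q∈))
    where
    flip : ∀ p q → -ᴾ (p -ᴾ q) ≃ q -ᴾ p
    flip = solve-∀ ℤ[t]ᴬ

  ≡-trans : ∀ {p q r} → p ≡[ G ] q → q ≡[ G ] r → p ≡[ G ] r
  ≡-trans {p} {q} {r} (≡-by p-q∈) (≡-by q-r∈) = ≡-by (∈-resp-≃ (telescope p q r) (∈-+ p-q∈ q-r∈))
    where
    telescope : ∀ p q r → (p -ᴾ q) +ᴾ (q -ᴾ r) ≃ p -ᴾ r
    telescope = solve-∀ ℤ[t]ᴬ

  ≡-+ : ∀ {p p′ q q′} → p ≡[ G ] p′ → q ≡[ G ] q′ → p +ᴾ q ≡[ G ] p′ +ᴾ q′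
  ≡-+ {p} {p′} {q} {q′} (≡-by p∈) (≡-by q∈) =
    ≡-by (∈-resp-≃ (regroup p p′ q q′) (∈-+ p∈ q∈))
    where
    regroup : ∀ p p′ q q′ → (p -ᴾ p′) +ᴾ (q -ᴾ q′) ≃ (p +ᴾ q) -ᴾ (p′ +ᴾ q′)
    regroup = solve-∀ ℤ[t]ᴬ

  ≡--ᴾ : ∀ {p p′} → p ≡[ G ] p′ → -ᴾ p ≡[ G ] -ᴾ p′
  ≡--ᴾ {p} {p′} (≡-by p∈) = ≡-by (∈-resp-≃ (negate p p′) (∈--ᴾ p∈))
    where
    negate : ∀ p p′ → -ᴾ (p -ᴾ p′) ≃ (-ᴾ p) -ᴾ (-ᴾ p′)
    negate = solve-∀ ℤ[t]ᴬ

  ≡-* : ∀ {p p′ q q′} → p ≡[ G ] p′ → q ≡[ G ] q′ → p *ᴾ q ≡[ G ] p′ *ᴾ q′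
  ≡-* {p} {p′} {q} {q′} (≡-by p∈) (≡-by q∈) =
    ≡-by (∈-resp-≃ (product-difference p p′ q q′) (∈-+ (∈-* q p∈) (∈-* p′ q∈)))
    where
    product-difference : ∀ p p′ q q′ →
                         q *ᴾ (p -ᴾ p′) +ᴾ p′ *ᴾ (q -ᴾ q′) ≃ p *ᴾ q -ᴾ p′ *ᴾ q′
    product-difference = solve-∀ ℤ[t]ᴬ

ℤ[t]/ : (Poly → Set) → CommutativeRing 0ℓ 0ℓ
ℤ[t]/ G = record
  { Carrier = Poly ; _≈_ = _≡[ G ]_ ; _+_ = _+ᴾ_ ; _*_ = _*ᴾ_ ; -_ = -ᴾ_ ; 0# = [] ; 1# = 1ᴾ
  ; isCommutativeRing = record
    { isRing = record
      { +-isAbelianGroup = record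
        { isGroup = record
          { isMonoid = record
            { isSemigroup = record
              { isMagma = record
                { isEquivalence = record { refl = ≃⇒≡ ≃-refl ; sym = ≡-sym ; trans = ≡-trans }
                ; ∙-cong = ≡-+ }
              ; assoc = λ p q r → ≃⇒≡ (R.+-assoc p q r) }
            ; identity = (λ p → ≃⇒≡ (R.+-identityˡ p)) , (λ p → ≃⇒≡ (R.+-identityʳ p)) }
          ; inverse = (λ p → ≃⇒≡ (R.-‿inverseˡ p)) , (λ p → ≃⇒≡ (R.-‿inverseʳ p))
          ; ⁻¹-cong = ≡--ᴾ }
        ; comm = λ p q → ≃⇒≡ (R.+-comm p q) }
      ; *-cong = ≡-*
      ; *-assoc = λ p q r → ≃⇒≡ (R.*-assoc p q r)
      ; *-identity = (λ p → ≃⇒≡ (R.*-identityˡ p)) , (λ p → ≃⇒≡ (R.*-identityʳ p))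
      ; distrib = (λ p q r → ≃⇒≡ (R.distribˡ p q r)) , (λ p q r → ≃⇒≡ (R.distribʳ p q r)) }
    ; *-comm = λ p q → ≃⇒≡ (R.*-comm p q) } }
  where module R = CommutativeRing ℤ[t]

module ≡[_]-Reasoning (G : Poly → Set) = SetoidReasoning (CommutativeRing.setoid (ℤ[t]/ G))

module _ {G : Poly → Set} where

  ≡-refl : ∀ {p} → p ≡[ G ] p
  ≡-refl = ≃⇒≡ ≃-refl

  ≡-+ˡ : ∀ p {q q′} → q ≡[ G ] q′ → p +ᴾ q ≡[ G ] p +ᴾ q′
  ≡-+ˡ p = ≡-+ (≡-refl {p})

  ≡-+ʳ : ∀ {p p′} q → p ≡[ G ] p′ → p +ᴾ q ≡[ G ] p′ +ᴾ q
  ≡-+ʳ q p≡p′ = ≡-+ p≡p′ (≡-refl {q})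

  ≡-*ˡ : ∀ p {q q′} → q ≡[ G ] q′ → p *ᴾ q ≡[ G ] p *ᴾ q′
  ≡-*ˡ p = ≡-* (≡-refl {p})

  ≡-*ʳ : ∀ {p p′} q → p ≡[ G ] p′ → p *ᴾ q ≡[ G ] p′ *ᴾ q
  ≡-*ʳ q p≡p′ = ≡-* p≡p′ (≡-refl {q})

  ≡-· : ∀ c {p p′} → p ≡[ G ] p′ → c ·ᴾ p ≡[ G ] c ·ᴾ p′
  ≡-· c {p} {p′} p≡p′ = ≡-trans (≃⇒≡ (≃-sym (constᴾ-*ᴾ c p)))
                          (≡-trans (≡-*ˡ (constᴾ c) p≡p′) (≃⇒≡ (constᴾ-*ᴾ c p′)))

  ≡-^ : ∀ {p q} k → p ≡[ G ] q → p ^ᴾ k ≡[ G ] q ^ᴾ k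
  ≡-^ zero    _   = ≡-refl
  ≡-^ (suc k) p≡q = ≡-* p≡q (≡-^ k p≡q)

  ≡[]⇒∈ : ∀ {p} → p ≡[ G ] [] → p ∈ G
  ≡[]⇒∈ {p} (≡-by p∈) = ∈-resp-≃ (+ᴾ-identityʳ p) p∈

  ∈⇒≡[] : ∀ {p} → p ∈ G → p ≡[ G ] []
  ∈⇒≡[] {p} p∈ = ≡-by (∈-resp-≃ (≃-sym (+ᴾ-identityʳ p)) p∈)

  ∘ᴾ-≡ : ∀ p {q q′} → q ≡[ G ] q′ → p ∘ᴾ q ≡[ G ] p ∘ᴾ q′
  ∘ᴾ-≡ []      _   = ≡-refl
  ∘ᴾ-≡ (a ∷ p) q≡q′ = ≡-+ˡ (constᴾ a) (≡-* q≡q′ (∘ᴾ-≡ p q≡q′))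

≡-mono : ∀ {G H} → (∀ {g} → G g → g ∈ H) → ∀ {p q} → p ≡[ G ] q → p ≡[ H ] q
≡-mono G⊆H (≡-by p-q∈) = ≡-by (∈-mono G⊆H p-q∈)

≡-∘ᴾ : ∀ {G H} t → (∀ {g} → G g → g ∘ᴾ t ∈ H) →
       ∀ {p q} → p ≡[ G ] q → p ∘ᴾ t ≡[ H ] q ∘ᴾ t
≡-∘ᴾ t G∘t⊆H {p} {q} (≡-by p-q∈) = ≡-by (∈-resp-≃ (∘ᴾ-- p q t) (∘ᴾ-∈ t G∘t⊆H p-q∈))

ψ-≡ : ∀ {m m′} → m ≡ m′ → ψ m ≃ ψ m′
ψ-≡ refl = ≃-refl

ψ-rec : ∀ k → X *ᴾ ψ (suc k) ≃ ψ (suc (suc k)) +ᴾ ψ k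
ψ-rec k = cancel (X *ᴾ ψ (suc k)) (ψ k)
  where
  cancel : ∀ p q → p ≃ (p -ᴾ q) +ᴾ q
  cancel = solve-∀ ℤ[t]ᴬ

ψ-product : ∀ b d → ψ (b + d) *ᴾ ψ b ≃ ψ (b + b + d) +ᴾ ψ d
ψ-product zero          d = double (ψ d)
  where
  double : ∀ p → p *ᴾ constᴾ (+ 2) ≃ p +ᴾ p
  double = solve-∀ ℤ[t]ᴬ
ψ-product (suc zero)    d = ≃-trans (*ᴾ-comm (ψ (suc d)) X) (ψ-rec d)
ψ-product (suc (suc b)) d = begin
  ψ a *ᴾ (X *ᴾ ψ (suc b) -ᴾ ψ b)
    ≈⟨ expand (ψ a) X (ψ (suc b)) (ψ b) ⟩
  X *ᴾ (ψ a *ᴾ ψ (suc b)) -ᴾ ψ a *ᴾ ψ b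
    ≈⟨ +ᴾ-cong (*ᴾ-congˡ X (≃-trans (*ᴾ-congʳ (ψ (suc b)) (ψ-≡ a≡1+b+1+d))
                                    (ψ-product (suc b) (suc d))))
               (-ᴾ-cong (≃-trans (*ᴾ-congʳ (ψ b) (ψ-≡ a≡b+2+d)) (ψ-product b (suc (suc d))))) ⟩
  X *ᴾ (ψ (suc b + suc b + suc d) +ᴾ ψ (suc d)) -ᴾ (ψ N +ᴾ ψ (suc (suc d)))
    ≈⟨ +ᴾ-congʳ _ (*ᴾ-congˡ X (+ᴾ-congʳ (ψ (suc d)) (ψ-≡ (index₁ b d)))) ⟩
  X *ᴾ (ψ (suc N) +ᴾ ψ (suc d)) -ᴾ (ψ N +ᴾ ψ (suc (suc d)))
    ≈⟨ +ᴾ-congʳ _ (≃-trans (*ᴾ-distribˡ X (ψ (suc N)) (ψ (suc d))) (+ᴾ-cong (ψ-rec N) (ψ-rec d))) ⟩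
  ((ψ (suc (suc N)) +ᴾ ψ N) +ᴾ (ψ (suc (suc d)) +ᴾ ψ d)) -ᴾ (ψ N +ᴾ ψ (suc (suc d)))
    ≈⟨ cancel (ψ (suc (suc N))) (ψ N) (ψ (suc (suc d))) (ψ d) ⟩
  ψ (suc (suc N)) +ᴾ ψ d
    ≈⟨ +ᴾ-congʳ (ψ d) (ψ-≡ (index₂ b d)) ⟨
  ψ (suc (suc b) + suc (suc b) + d) +ᴾ ψ d ∎
  where
  open ≃-Reasoning
  a = suc (suc b) + d
  N = b + b + suc (suc d)
  a≡1+b+1+d : a ≡ suc b + suc d
  a≡1+b+1+d = cong suc (≡.sym (ℕₚ.+-suc b d))
  a≡b+2+d : a ≡ b + suc (suc d)
  a≡b+2+d = ≡.sym (≡.trans (ℕₚ.+-suc b (suc d)) (cong suc (ℕₚ.+-suc b d)))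
  index₁ : ∀ b d → suc b + suc b + suc d ≡ suc (b + b + suc (suc d))
  index₁ = ℕ-solve-∀
  index₂ : ∀ b d → suc (suc b) + suc (suc b) + d ≡ suc (suc (b + b + suc (suc d)))
  index₂ = ℕ-solve-∀
  expand : ∀ p x q r → p *ᴾ (x *ᴾ q -ᴾ r) ≃ x *ᴾ (p *ᴾ q) -ᴾ p *ᴾ r
  expand = solve-∀ ℤ[t]ᴬ
  cancel : ∀ p q r s → ((p +ᴾ q) +ᴾ (r +ᴾ s)) -ᴾ (q +ᴾ r) ≃ p +ᴾ s
  cancel = solve-∀ ℤ[t]ᴬ

ψ-*-ψ : ∀ {a b} → b ≤ a → ψ a *ᴾ ψ b ≃ ψ (a + b) +ᴾ ψ (a ∸ b)
ψ-*-ψ {a} {b} b≤a = begin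
  ψ a *ᴾ ψ b                       ≈⟨ *ᴾ-congʳ (ψ b) (ψ-≡ b+[a∸b]≡a) ⟨
  ψ (b + (a ∸ b)) *ᴾ ψ b           ≈⟨ ψ-product b (a ∸ b) ⟩
  ψ (b + b + (a ∸ b)) +ᴾ ψ (a ∸ b) ≈⟨ +ᴾ-congʳ (ψ (a ∸ b)) (ψ-≡ index) ⟩
  ψ (a + b) +ᴾ ψ (a ∸ b)           ∎
  where
  open ≃-Reasoning
  b+[a∸b]≡a = ℕₚ.m+[n∸m]≡n b≤a
  index : b + b + (a ∸ b) ≡ a + b
  index = ≡.trans (ℕₚ.+-assoc b b (a ∸ b)) (≡.trans (cong (λ z → b + z) b+[a∸b]≡a) (ℕₚ.+-comm b a))

∣+m-+n∣≡m∸n : ∀ {m n} → n ≤ m → ℤ.∣ + m ℤ.- + n ∣ ≡ m ∸ n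
∣+m-+n∣≡m∸n {m} {n} n≤m = cong ℤ.∣_∣ (≡.trans (ℤₚ.m-n≡m⊖n m n) (ℤₚ.⊖-≥ n≤m))

≡±-translate : ∀ n b q → (b + q * n) ≡± b mod n
≡±-translate n b q =
  inj₁ (divides q (≡.trans (∣+m-+n∣≡m∸n (ℕₚ.m≤m+n b (q * n))) (ℕₚ.m+n∸m≡n b (q * n))))

≡±-complement : ∀ {n a b} → a + b ≡ n → a ≡± b mod n
≡±-complement {n} a+b≡n = inj₂ (divides 1 (≡.trans a+b≡n (≡.sym (ℕₚ.*-identityˡ n))))

module ≡±-Closure (n : ℕ) .{{_ : ℕ.NonZero n}}
  (_~_ : ℕ → ℕ → Set) (~-isEquivalence : IsEquivalence _~_)
  (~-translate : ∀ k → (k + n) ~ k) (~-reflect : ∀ j → j ≤ n → (n ∸ j) ~ j) where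

  private
    ~-setoid : Setoid 0ℓ 0ℓ
    ~-setoid = record { isEquivalence = ~-isEquivalence }
    open IsEquivalence ~-isEquivalence renaming (refl to ~-refl; sym to ~-sym)
    open SetoidReasoning ~-setoid

  ~-translate* : ∀ r q → (r + q * n) ~ r
  ~-translate* r zero    = ≡.subst (_~ r) (≡.sym (ℕₚ.+-identityʳ r)) ~-refl
  ~-translate* r (suc q) = begin
    r + suc q * n    ≡⟨ reorder r q n ⟩
    r + q * n + n    ≈⟨ ~-translate (r + q * n) ⟩
    r + q * n        ≈⟨ ~-translate* r q ⟩
    r                ∎
    where
    reorder : ∀ r q n → r + suc q * n ≡ r + q * n + n
    reorder = ℕ-solve-∀

  ~-% : ∀ a → a ~ (a % n)
  ~-% a = ≡.subst (_~ (a % n)) (≡.sym (m≡m%n+[m/n]*n a n)) (~-translate* (a % n) (a / n))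

  ∣-∸⇒~ : ∀ {a b} → b ≤ a → n ∣ a ∸ b → a ~ b
  ∣-∸⇒~ {a} {b} b≤a (divides q a∸b≡qn) = ≡.subst (_~ b) b+qn≡a (~-translate* b q)
    where b+qn≡a = ≡.trans (cong (λ z → b + z) (≡.sym a∸b≡qn)) (ℕₚ.m+[n∸m]≡n b≤a)

  residues-sum : ∀ {r s} → r < n → s < n → n ∣ r + s → r + s ≡ 0 ⊎ r + s ≡ n
  residues-sum r<n s<n (divides zero          r+s≡0)   = inj₁ r+s≡0
  residues-sum r<n s<n (divides (suc zero)    r+s≡1n)  = inj₂ (≡.trans r+s≡1n (ℕₚ.+-identityʳ n))
  residues-sum r<n s<n (divides (suc (suc k)) r+s≡kn) =
    ⊥-elim (ℕₚ.<⇒≱ (ℕₚ.+-mono-< r<n s<n)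
                   (≡.subst (n + n ≤_) (≡.sym r+s≡kn) (ℕₚ.+-monoʳ-≤ n (ℕₚ.m≤m+n n (k * n)))))

  ∣-+⇒~ : ∀ a b → n ∣ a + b → a ~ b
  ∣-+⇒~ a b n∣a+b with residues-sum (m%n<n a n) (m%n<n b n) n∣r+s
    where
    n∣r+s : n ∣ a % n + b % n
    n∣r+s = m%n≡0⇒n∣m _ n (≡.trans (≡.sym (%-distribˡ-+ a b n)) (n∣m⇒m%n≡0 (a + b) n n∣a+b))
  ... | inj₁ r+s≡0 = begin
    a        ≈⟨ ~-% a ⟩
    a % n    ≡⟨ ℕₚ.m+n≡0⇒m≡0 (a % n) r+s≡0 ⟩
    0        ≡⟨ ℕₚ.m+n≡0⇒n≡0 (a % n) r+s≡0 ⟨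
    b % n    ≈⟨ ~-% b ⟨
    b        ∎
  ... | inj₂ r+s≡n = begin
    a                      ≈⟨ ~-% a ⟩
    a % n                  ≈⟨ ~-reflect (a % n) (ℕₚ.<⇒≤ (m%n<n a n)) ⟨
    n ∸ a % n              ≡⟨ cong (_∸ a % n) r+s≡n ⟨
    a % n + b % n ∸ a % n  ≡⟨ ℕₚ.m+n∸m≡n (a % n) (b % n) ⟩
    b % n                  ≈⟨ ~-% b ⟨
    b                      ∎

  ≡±⇒~ : ∀ {a b} → a ≡± b mod n → a ~ b
  ≡±⇒~ {a} {b} (inj₁ n∣a-b) with ℕₚ.≤-total b a
  ... | inj₁ b≤a = ∣-∸⇒~ b≤a (≡.subst (n ∣_) (∣+m-+n∣≡m∸n b≤a) n∣a-b)
  ... | inj₂ a≤b = ~-sym (∣-∸⇒~ a≤b (≡.subst (n ∣_) ∣a-b∣≡b∸a n∣a-b))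
    where ∣a-b∣≡b∸a = ≡.trans (ℤₚ.∣i-j∣≡∣j-i∣ (+ a) (+ b)) (∣+m-+n∣≡m∸n a≤b)
  ≡±⇒~ {a} {b} (inj₂ n∣a+b) = ∣-+⇒~ a b n∣a+b

m∸n≡suc[m∸suc[n]] : ∀ {m n} → n < m → m ∸ n ≡ suc (m ∸ suc n)
m∸n≡suc[m∸suc[n]] {suc m} {zero}  _         = refl
m∸n≡suc[m∸suc[n]] {suc m} {suc n} (s≤s n<m) = m∸n≡suc[m∸suc[n]] n<m

δ : ℕ → ℕ → ℤ
δ zero    zero    = + 1
δ zero    (suc _) = 0ℤ
δ (suc _) zero    = 0ℤ
δ (suc j) (suc k) = δ j k

δ-refl : ∀ k → δ k k ≡ + 1
δ-refl zero    = refl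
δ-refl (suc k) = δ-refl k

δ-≢ : ∀ {j k} → j ≢ k → δ j k ≡ 0ℤ
δ-≢ {zero}  {zero}  j≢k = ⊥-elim (j≢k refl)
δ-≢ {zero}  {suc k} _   = refl
δ-≢ {suc j} {zero}  _   = refl
δ-≢ {suc j} {suc k} j≢k = δ-≢ (λ j≡k → j≢k (cong suc j≡k))

δ-∸ : ∀ {n k t} → k ≤ n → t ≤ n → δ (n ∸ k) t ≡ δ k (n ∸ t)
δ-∸ {n} {k} {t} k≤n t≤n with k ℕ.≟ n ∸ t
... | yes refl =
  ≡.trans (cong (λ m → δ m t) (ℕₚ.m∸[m∸n]≡n t≤n)) (≡.trans (δ-refl t) (≡.sym (δ-refl (n ∸ t))))
... | no  k≢n∸t = ≡.trans (δ-≢ n∸k≢t) (≡.sym (δ-≢ k≢n∸t))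
  where
  n∸k≢t : n ∸ k ≢ t
  n∸k≢t n∸k≡t = k≢n∸t (≡.trans (≡.sym (ℕₚ.m∸[m∸n]≡n k≤n)) (cong (n ∸_) n∸k≡t))

∑ℤ-δ : ∀ j (f : ℕ → ℤ) {i} → i < j → ∑ℤ[ k < j ] f k ℤ.* δ k i ≡ f i
∑ℤ-δ j f {i} i<j = ≡.trans
  (Sumℤ.∑-single j i i<j (λ k _ k≢i → ≡.trans (cong (f k ℤ.*_) (δ-≢ k≢i)) (ℤₚ.*-zeroʳ (f k))))
  (≡.trans (cong (f i ℤ.*_) (δ-refl i)) (ℤₚ.*-identityʳ (f i)))

module Cyclic (n′ : ℕ) where

  n : ℕ
  n = suc n′

  infix 4 _≡ᶜ_
  _≡ᶜ_ : Poly → Poly → Set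
  p ≡ᶜ q = p ≡[ GenCyc n ] q

  x⁻¹ : Poly
  x⁻¹ = X ^ᴾ n′

  y : Poly
  y = X +ᴾ x⁻¹

  Xⁿ≡1 : X ^ᴾ n ≡ᶜ 1ᴾ
  Xⁿ≡1 = ≡-by (generator∈ (λ _ → refl))

  X*x⁻¹≡1 : X *ᴾ x⁻¹ ≡ᶜ 1ᴾ
  X*x⁻¹≡1 = Xⁿ≡1

  ^ᴾ-≡1 : ∀ {w} k → w ≡ᶜ 1ᴾ → w ^ᴾ k ≡ᶜ 1ᴾ
  ^ᴾ-≡1 k w≡1 = ≡-trans (≡-^ k w≡1) (≃⇒≡ (1^ᴾ k))
    where
    1^ᴾ : ∀ k → 1ᴾ ^ᴾ k ≃ 1ᴾ
    1^ᴾ zero    = ≃-refl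
    1^ᴾ (suc k) = ≃-trans (*ᴾ-identityˡ _) (1^ᴾ k)

  x⁻¹ⁿ≡1 : x⁻¹ ^ᴾ n ≡ᶜ 1ᴾ
  x⁻¹ⁿ≡1 = begin
    (X ^ᴾ n′) ^ᴾ n   ≈⟨ ≃⇒≡ (^ᴾ-* X n′ n) ⟨
    X ^ᴾ (n′ * n)    ≡⟨ cong (X ^ᴾ_) (ℕₚ.*-comm n′ n) ⟩
    X ^ᴾ (n * n′)    ≈⟨ ≃⇒≡ (^ᴾ-* X n n′) ⟩
    (X ^ᴾ n) ^ᴾ n′   ≈⟨ ^ᴾ-≡1 n′ Xⁿ≡1 ⟩
    1ᴾ               ∎
    where open ≡[_]-Reasoning (GenCyc n)

  ^ᴾ-translate : ∀ {w} → w ^ᴾ n ≡ᶜ 1ᴾ → ∀ a → w ^ᴾ (a + n) ≡ᶜ w ^ᴾ a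
  ^ᴾ-translate {w} wⁿ≡1 a = begin
    w ^ᴾ (a + n)         ≈⟨ ≃⇒≡ (^ᴾ-+ w a n) ⟩
    w ^ᴾ a *ᴾ w ^ᴾ n     ≈⟨ ≡-*ˡ (w ^ᴾ a) wⁿ≡1 ⟩
    w ^ᴾ a *ᴾ 1ᴾ         ≈⟨ ≃⇒≡ (*ᴾ-identityʳ _) ⟩
    w ^ᴾ a               ∎
    where open ≡[_]-Reasoning (GenCyc n)

  ^ᴾ-reflect : ∀ {u w} → u *ᴾ w ≡ᶜ 1ᴾ → u ^ᴾ n ≡ᶜ 1ᴾ → ∀ j → j ≤ n → u ^ᴾ (n ∸ j) ≡ᶜ w ^ᴾ j
  ^ᴾ-reflect {u} {w} uw≡1 uⁿ≡1 j j≤n = begin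
    u ^ᴾ (n ∸ j)                         ≈⟨ ≃⇒≡ (*ᴾ-identityʳ _) ⟨
    u ^ᴾ (n ∸ j) *ᴾ 1ᴾ                   ≈⟨ ≡-*ˡ (u ^ᴾ (n ∸ j)) (^ᴾ-≡1 j uw≡1) ⟨
    u ^ᴾ (n ∸ j) *ᴾ (u *ᴾ w) ^ᴾ j        ≈⟨ ≃⇒≡ (*ᴾ-congˡ (u ^ᴾ (n ∸ j)) (^ᴾ-*ᴾ-distrib u w j)) ⟩
    u ^ᴾ (n ∸ j) *ᴾ (u ^ᴾ j *ᴾ w ^ᴾ j)   ≈⟨ ≃⇒≡ (*ᴾ-assoc (u ^ᴾ (n ∸ j)) _ _) ⟨
    (u ^ᴾ (n ∸ j) *ᴾ u ^ᴾ j) *ᴾ w ^ᴾ j   ≈⟨ ≃⇒≡ (*ᴾ-congʳ (w ^ᴾ j) (^ᴾ-+ u (n ∸ j) j)) ⟨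
    u ^ᴾ (n ∸ j + j) *ᴾ w ^ᴾ j           ≡⟨ cong (λ m → u ^ᴾ m *ᴾ w ^ᴾ j) (ℕₚ.m∸n+n≡m j≤n) ⟩
    u ^ᴾ n *ᴾ w ^ᴾ j                     ≈⟨ ≡-*ʳ (w ^ᴾ j) uⁿ≡1 ⟩
    1ᴾ *ᴾ w ^ᴾ j                         ≈⟨ ≃⇒≡ (*ᴾ-identityˡ _) ⟩
    w ^ᴾ j                               ∎
    where open ≡[_]-Reasoning (GenCyc n)

  x⁻¹*X≡1 : x⁻¹ *ᴾ X ≡ᶜ 1ᴾ
  x⁻¹*X≡1 = ≡-trans (≃⇒≡ (*ᴾ-comm x⁻¹ X)) X*x⁻¹≡1

  xⁿ⁻ʲ≡x⁻ʲ : ∀ j → j ≤ n → X ^ᴾ (n ∸ j) ≡ᶜ x⁻¹ ^ᴾ j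
  xⁿ⁻ʲ≡x⁻ʲ = ^ᴾ-reflect X*x⁻¹≡1 Xⁿ≡1

  φ-ψ : ∀ k → ψ k ∘ᴾ y ≡ᶜ X ^ᴾ k +ᴾ x⁻¹ ^ᴾ k
  φ-ψ zero          = ≃⇒≡ (∘ᴾ-const (+ 2) y)
  φ-ψ (suc zero)    =
    ≃⇒≡ (≃-trans (∘ᴾ-X y) (+ᴾ-cong (≃-sym (*ᴾ-identityʳ X)) (≃-sym (*ᴾ-identityʳ x⁻¹))))
  φ-ψ (suc (suc k)) = begin
    (X *ᴾ ψ (suc k) -ᴾ ψ k) ∘ᴾ y
      ≈⟨ ≃⇒≡ (≃-trans (∘ᴾ-- (X *ᴾ ψ (suc k)) (ψ k) y)
                      (+ᴾ-congʳ _ (≃-trans (∘ᴾ-* X (ψ (suc k)) y) (*ᴾ-congʳ _ (∘ᴾ-X y))))) ⟩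
    y *ᴾ (ψ (suc k) ∘ᴾ y) -ᴾ ψ k ∘ᴾ y
      ≈⟨ ≡-+ (≡-*ˡ y (φ-ψ (suc k))) (≡--ᴾ (φ-ψ k)) ⟩
    y *ᴾ (X *ᴾ u +ᴾ x⁻¹ *ᴾ w) -ᴾ (u +ᴾ w)
      ≈⟨ ≃⇒≡ (expand X x⁻¹ u w) ⟩
    (X *ᴾ (X *ᴾ u) +ᴾ x⁻¹ *ᴾ (x⁻¹ *ᴾ w)) +ᴾ ((X *ᴾ x⁻¹) *ᴾ (u +ᴾ w) -ᴾ (u +ᴾ w))
      ≈⟨ ≡-+ˡ (X *ᴾ (X *ᴾ u) +ᴾ x⁻¹ *ᴾ (x⁻¹ *ᴾ w)) (≡-+ʳ (-ᴾ (u +ᴾ w)) (≡-*ʳ (u +ᴾ w) X*x⁻¹≡1)) ⟩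
    (X *ᴾ (X *ᴾ u) +ᴾ x⁻¹ *ᴾ (x⁻¹ *ᴾ w)) +ᴾ (1ᴾ *ᴾ (u +ᴾ w) -ᴾ (u +ᴾ w))
      ≈⟨ ≃⇒≡ (cancel (X *ᴾ (X *ᴾ u) +ᴾ x⁻¹ *ᴾ (x⁻¹ *ᴾ w)) (u +ᴾ w)) ⟩
    X *ᴾ (X *ᴾ u) +ᴾ x⁻¹ *ᴾ (x⁻¹ *ᴾ w) ∎
    where
    open ≡[_]-Reasoning (GenCyc n)
    u = X ^ᴾ k
    w = x⁻¹ ^ᴾ k
    expand : ∀ a b u w → (a +ᴾ b) *ᴾ (a *ᴾ u +ᴾ b *ᴾ w) -ᴾ (u +ᴾ w) ≃
                         (a *ᴾ (a *ᴾ u) +ᴾ b *ᴾ (b *ᴾ w)) +ᴾ ((a *ᴾ b) *ᴾ (u +ᴾ w) -ᴾ (u +ᴾ w))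
    expand = solve-∀ ℤ[t]ᴬ
    cancel : ∀ p q → p +ᴾ (1ᴾ *ᴾ q -ᴾ q) ≃ p
    cancel = solve-∀ ℤ[t]ᴬ

  φ-ψ-translate : ∀ k → ψ (k + n) ∘ᴾ y ≡ᶜ ψ k ∘ᴾ y
  φ-ψ-translate k = begin
    ψ (k + n) ∘ᴾ y                  ≈⟨ φ-ψ (k + n) ⟩
    X ^ᴾ (k + n) +ᴾ x⁻¹ ^ᴾ (k + n)  ≈⟨ ≡-+ (^ᴾ-translate Xⁿ≡1 k) (^ᴾ-translate x⁻¹ⁿ≡1 k) ⟩
    X ^ᴾ k +ᴾ x⁻¹ ^ᴾ k              ≈⟨ φ-ψ k ⟨
    ψ k ∘ᴾ y                        ∎
    where open ≡[_]-Reasoning (GenCyc n)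

  φ-ψ-reflect : ∀ j → j ≤ n → ψ (n ∸ j) ∘ᴾ y ≡ᶜ ψ j ∘ᴾ y
  φ-ψ-reflect j j≤n = begin
    ψ (n ∸ j) ∘ᴾ y                  ≈⟨ φ-ψ (n ∸ j) ⟩
    X ^ᴾ (n ∸ j) +ᴾ x⁻¹ ^ᴾ (n ∸ j)  ≈⟨ ≡-+ (xⁿ⁻ʲ≡x⁻ʲ j j≤n) (^ᴾ-reflect x⁻¹*X≡1 x⁻¹ⁿ≡1 j j≤n) ⟩
    x⁻¹ ^ᴾ j +ᴾ X ^ᴾ j              ≈⟨ ≃⇒≡ (+ᴾ-comm (x⁻¹ ^ᴾ j) (X ^ᴾ j)) ⟩
    X ^ᴾ j +ᴾ x⁻¹ ^ᴾ j              ≈⟨ φ-ψ j ⟨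
    ψ j ∘ᴾ y                        ∎
    where open ≡[_]-Reasoning (GenCyc n)

  φ-ψ-≡± : ∀ {a b} → a ≡± b mod n → ψ a ∘ᴾ y ≡ᶜ ψ b ∘ᴾ y
  φ-ψ-≡± {a} {b} = ≡±-Closure.≡±⇒~ n (λ a b → ψ a ∘ᴾ y ≡ᶜ ψ b ∘ᴾ y)
    record { refl = λ {a} → ≡-refl {p = ψ a ∘ᴾ y} ; sym = ≡-sym ; trans = ≡-trans }
    φ-ψ-translate φ-ψ-reflect {a} {b}

  -- For t < n, cycCoeff t p is the coefficient of xᵗ in the reduction of p
  -- modulo xⁿ − 1, i.e. the sum of the coefficients of p at indices ≡ t (mod n).
  cycCoeff : ℕ → Poly → ℤ
  cycCoeff t       []      = 0ℤ
  cycCoeff zero    (a ∷ p) = a ℤ.+ cycCoeff n′ p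
  cycCoeff (suc t) (a ∷ p) = cycCoeff t p

  cycPred : ℕ → ℕ
  cycPred zero    = n′
  cycPred (suc t) = t

  cycPred-≤ : ∀ {t} → t ≤ n′ → cycPred t ≤ n′
  cycPred-≤ {zero}  _     = ℕₚ.≤-refl
  cycPred-≤ {suc t} t<n′ = ℕₚ.<⇒≤ t<n′

  cycCoeff-≃[] : ∀ t {p} → p ≃ [] → cycCoeff t p ≡ 0ℤ
  cycCoeff-≃[] t       {[]}    _   = refl
  cycCoeff-≃[] zero    {a ∷ p} p≃0 with ∷≃[]⁻ p≃0
  ... | refl , p≃[] = cong (λ z → 0ℤ ℤ.+ z) (cycCoeff-≃[] n′ p≃[])
  cycCoeff-≃[] (suc t) {a ∷ p} p≃0 = cycCoeff-≃[] t (proj₂ (∷≃[]⁻ p≃0))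

  cycCoeff-cong : ∀ t {p q} → p ≃ q → cycCoeff t p ≡ cycCoeff t q
  cycCoeff-cong t       {[]}              []≃q = ≡.sym (cycCoeff-≃[] t (≃-sym []≃q))
  cycCoeff-cong t       {a ∷ p} {[]}      p≃[] = cycCoeff-≃[] t p≃[]
  cycCoeff-cong zero    {a ∷ p} {b ∷ q}   p≃q with ∷-injective p≃q
  ... | refl , p≃q′ = cong (λ z → a ℤ.+ z) (cycCoeff-cong n′ p≃q′)
  cycCoeff-cong (suc t) {a ∷ p} {b ∷ q}   p≃q = cycCoeff-cong t (proj₂ (∷-injective p≃q))

  cycCoeff-+ : ∀ t p q → cycCoeff t (p +ᴾ q) ≡ cycCoeff t p ℤ.+ cycCoeff t q
  cycCoeff-+ t       []      q       = ≡.sym (ℤₚ.+-identityˡ _)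
  cycCoeff-+ t       (a ∷ p) []      = ≡.sym (ℤₚ.+-identityʳ _)
  cycCoeff-+ zero    (a ∷ p) (b ∷ q) =
    ≡.trans (cong (λ z → (a ℤ.+ b) ℤ.+ z) (cycCoeff-+ n′ p q)) (ℤ-interchange a b _ _)
    where
    ℤ-interchange : ∀ a b c d → (a ℤ.+ b) ℤ.+ (c ℤ.+ d) ≡ (a ℤ.+ c) ℤ.+ (b ℤ.+ d)
    ℤ-interchange = ℤ-solve-∀
  cycCoeff-+ (suc t) (a ∷ p) (b ∷ q) = cycCoeff-+ t p q

  cycCoeff-· : ∀ t c p → cycCoeff t (c ·ᴾ p) ≡ c ℤ.* cycCoeff t p
  cycCoeff-· t       c []      = ≡.sym (ℤₚ.*-zeroʳ c)
  cycCoeff-· zero    c (a ∷ p) =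
    ≡.trans (cong (λ z → c ℤ.* a ℤ.+ z) (cycCoeff-· n′ c p)) (≡.sym (ℤₚ.*-distribˡ-+ c a _))
  cycCoeff-· (suc t) c (a ∷ p) = cycCoeff-· t c p

  cycCoeff-- : ∀ t p q → cycCoeff t (p -ᴾ q) ≡ cycCoeff t p ℤ.- cycCoeff t q
  cycCoeff-- t p q = begin
    cycCoeff t (p -ᴾ q)                       ≡⟨ cycCoeff-+ t p (-ᴾ q) ⟩
    cycCoeff t p ℤ.+ cycCoeff t (-ᴾ q)        ≡⟨ cong (cycCoeff t p +ℤ_) (cycCoeff-cong t (-ᴾ≃-1·ᴾ q)) ⟩
    cycCoeff t p ℤ.+ cycCoeff t (ℤ.-1ℤ ·ᴾ q)  ≡⟨ cong (cycCoeff t p +ℤ_) (cycCoeff-· t ℤ.-1ℤ q) ⟩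
    cycCoeff t p ℤ.+ ℤ.-1ℤ ℤ.* cycCoeff t q   ≡⟨ cong (cycCoeff t p +ℤ_) (ℤₚ.-1*i≡-i _) ⟩
    cycCoeff t p ℤ.- cycCoeff t q             ∎
    where
    open ≡.≡-Reasoning
    _+ℤ_ = ℤ._+_

  cycCoeff-∷ : ∀ t a p → cycCoeff t (a ∷ p) ≡ δ 0 t ℤ.* a ℤ.+ cycCoeff (cycPred t) p
  cycCoeff-∷ zero    a p = cong (ℤ._+ cycCoeff n′ p) (≡.sym (ℤₚ.*-identityˡ a))
  cycCoeff-∷ (suc t) a p = ≡.sym (ℤₚ.+-identityˡ _)

  cycCoeff-0∷ : ∀ t p → cycCoeff t (0ℤ ∷ p) ≡ cycCoeff (cycPred t) p
  cycCoeff-0∷ zero    p = ℤₚ.+-identityˡ _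
  cycCoeff-0∷ (suc t) p = refl

  cycCoeff-X* : ∀ t p → cycCoeff t (X *ᴾ p) ≡ cycCoeff (cycPred t) p
  cycCoeff-X* t p = ≡.trans (cycCoeff-cong t (X*ᴾ p)) (cycCoeff-0∷ t p)

  cycCoeff-X^ : ∀ {a t} → a ≤ n′ → t ≤ n′ → cycCoeff t (X ^ᴾ a) ≡ δ a t
  cycCoeff-X^ {zero}  {zero}  _     _    = refl
  cycCoeff-X^ {zero}  {suc t} _     _    = refl
  cycCoeff-X^ {suc a} {t}     a<n′ t≤n′ = begin
    cycCoeff t (X *ᴾ X ^ᴾ a)    ≡⟨ cycCoeff-X* t (X ^ᴾ a) ⟩
    cycCoeff (cycPred t) (X ^ᴾ a) ≡⟨ cycCoeff-X^ (ℕₚ.<⇒≤ a<n′) (cycPred-≤ t≤n′) ⟩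
    δ a (cycPred t)             ≡⟨ δ-cycPred t ⟩
    δ (suc a) t                 ∎
    where
    open ≡.≡-Reasoning
    δ-cycPred : ∀ t → δ a (cycPred t) ≡ δ (suc a) t
    δ-cycPred zero    = δ-≢ (ℕₚ.<⇒≢ a<n′)
    δ-cycPred (suc t) = refl

  cycCoeff-Xⁿ : ∀ {t} → t ≤ n′ → cycCoeff t (X ^ᴾ n) ≡ δ 0 t
  cycCoeff-Xⁿ {t} t≤n′ = ≡.trans (cycCoeff-X* t (X ^ᴾ n′))
    (≡.trans (cycCoeff-X^ ℕₚ.≤-refl (cycPred-≤ t≤n′)) (δ-n′-cycPred t t≤n′))
    where
    δ-n′-cycPred : ∀ t → t ≤ n′ → δ n′ (cycPred t) ≡ δ 0 t
    δ-n′-cycPred zero    _     = δ-refl n′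
    δ-n′-cycPred (suc t) t<n′ = δ-≢ (≡.≢-sym (ℕₚ.<⇒≢ t<n′))
  
  cycCoeff-*-cyclotomic : ∀ {t} p → t ≤ n′ → cycCoeff t (p *ᴾ (X ^ᴾ n -ᴾ 1ᴾ)) ≡ 0ℤ
  cycCoeff-*-cyclotomic {t} []      _     = refl
  cycCoeff-*-cyclotomic {t} (a ∷ p) t≤n′ = begin
    cycCoeff t (a ·ᴾ P +ᴾ (0ℤ ∷ p *ᴾ P))
      ≡⟨ cycCoeff-+ t (a ·ᴾ P) _ ⟩
    cycCoeff t (a ·ᴾ P) ℤ.+ cycCoeff t (0ℤ ∷ p *ᴾ P)
      ≡⟨ cong₂ ℤ._+_ (cycCoeff-· t a P) (cycCoeff-0∷ t (p *ᴾ P)) ⟩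
    a ℤ.* cycCoeff t P ℤ.+ cycCoeff (cycPred t) (p *ᴾ P)
      ≡⟨ cong₂ (λ u v → a ℤ.* u ℤ.+ v) cycCoeff-P (cycCoeff-*-cyclotomic p (cycPred-≤ t≤n′)) ⟩
    a ℤ.* 0ℤ ℤ.+ 0ℤ
      ≡⟨ cong (ℤ._+ 0ℤ) (ℤₚ.*-zeroʳ a) ⟩
    0ℤ ∎
    where
    open ≡.≡-Reasoning
    P = X ^ᴾ n -ᴾ 1ᴾ
    cycCoeff-P : cycCoeff t P ≡ 0ℤ
    cycCoeff-P = ≡.trans (cycCoeff-- t (X ^ᴾ n) 1ᴾ)
      (≡.trans (cong₂ ℤ._-_ (cycCoeff-Xⁿ t≤n′) (cycCoeff-X^ z≤n t≤n′)) (ℤₚ.+-inverseʳ (δ 0 t)))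

  cycCoeff-∈ : ∀ {t} → t ≤ n′ → ∀ {f} → f ∈ GenCyc n → cycCoeff t f ≡ 0ℤ
  cycCoeff-∈ {t} t≤n′ = ∈-induction (λ f → cycCoeff t f ≡ 0ℤ)
    (λ f≃f′ f↦0 → ≡.trans (≡.sym (cycCoeff-cong t f≃f′)) f↦0)
    refl
    (λ {f} {g} f↦0 g↦0 → ≡.trans (cycCoeff-+ t f g) (cong₂ ℤ._+_ f↦0 g↦0))
    (λ h {g} g≈P → ≡.trans (cycCoeff-cong t (*ᴾ-congˡ h ⟨ g≈P ⟩)) (cycCoeff-*-cyclotomic h t≤n′))

  cycCoeff-≡ᶜ : ∀ {t} → t ≤ n′ → ∀ {p q} → p ≡ᶜ q → cycCoeff t p ≡ cycCoeff t q
  cycCoeff-≡ᶜ {t} t≤n′ {p} {q} (≡-by p-q∈) =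
    ℤₚ.i-j≡0⇒i≡j _ _ (≡.trans (≡.sym (cycCoeff-- t p q)) (cycCoeff-∈ t≤n′ p-q∈))

  module Sumᶜ = FiniteSum (CommutativeRing.+-commutativeMonoid (ℤ[t]/ (GenCyc n)))

  reduce : Poly → Poly
  reduce p = ∑ᴾ[ t < n ] cycCoeff t p ·ᴾ X ^ᴾ t

  reduce-∷ : ∀ a p → reduce (a ∷ p) ≡ᶜ constᴾ a +ᴾ X *ᴾ reduce p
  reduce-∷ a p = begin
    reduce (a ∷ p)
      ≈⟨ ≃⇒≡ (Sumᴾ.∑-cong n (λ t _ → ≃-trans (≡⇒≃ (cong (_·ᴾ X ^ᴾ t) (cycCoeff-∷ t a p)))
                                              (·ᴾ-distribʳ (δ 0 t ℤ.* a) _ (X ^ᴾ t)))) ⟩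
    ∑ᴾ[ t < n ] ((δ 0 t ℤ.* a) ·ᴾ X ^ᴾ t +ᴾ c (cycPred t) ·ᴾ X ^ᴾ t)
      ≈⟨ ≃⇒≡ (Sumᴾ.∑-distrib n _ _) ⟩
    (∑ᴾ[ t < n ] (δ 0 t ℤ.* a) ·ᴾ X ^ᴾ t) +ᴾ (∑ᴾ[ t < n ] c (cycPred t) ·ᴾ X ^ᴾ t)
      ≈⟨ ≃⇒≡ (+ᴾ-cong constant-term (Sumᴾ.∑-shift n′ _)) ⟩
    constᴾ a +ᴾ (c n′ ·ᴾ 1ᴾ +ᴾ S)
      ≈⟨ ≃⇒≡ (+ᴾ-congˡ (constᴾ a) (+ᴾ-comm (c n′ ·ᴾ 1ᴾ) S)) ⟩
    constᴾ a +ᴾ (S +ᴾ c n′ ·ᴾ 1ᴾ)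
      ≈⟨ ≡-+ˡ (constᴾ a) (≡-+ˡ S (≡-· (c n′) Xⁿ≡1)) ⟨
    constᴾ a +ᴾ (S +ᴾ c n′ ·ᴾ X ^ᴾ n)
      ≈⟨ ≃⇒≡ (+ᴾ-congˡ (constᴾ a) X*reduce) ⟨
    constᴾ a +ᴾ X *ᴾ reduce p ∎
    where
    open ≡[_]-Reasoning (GenCyc n)
    c = λ t → cycCoeff t p
    S = ∑ᴾ[ t < n′ ] c t ·ᴾ X ^ᴾ suc t
    constant-term : (∑ᴾ[ t < n ] (δ 0 t ℤ.* a) ·ᴾ X ^ᴾ t) ≃ constᴾ a
    constant-term = ≃-trans (Sumᴾ.∑-single n 0 (s≤s z≤n) higher-terms)
                            (≃-trans (·ᴾ-1ᴾ (+ 1 ℤ.* a)) (∷-cong (ℤₚ.*-identityˡ a) ≃-refl))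
      where
      higher-terms : ∀ t → t < n → t ≢ 0 → (δ 0 t ℤ.* a) ·ᴾ X ^ᴾ t ≃ []
      higher-terms zero    _ 0≢0 = ⊥-elim (0≢0 refl)
      higher-terms (suc t) _ _   = ·ᴾ-zeroˡ _
    X*reduce : X *ᴾ reduce p ≃ S +ᴾ c n′ ·ᴾ X ^ᴾ n
    X*reduce = ≃-trans (homo-∑ ℤ[t]⁺ ℤ[t]⁺ (X *ᴾ_) (*ᴾ-zeroʳ X) (*ᴾ-distribˡ X) n _)
                       (Sumᴾ.∑-cong n (λ t _ → *ᴾ-·ᴾ-comm (c t) X (X ^ᴾ t)))

  ≡ᶜ-reduce : ∀ p → p ≡ᶜ reduce p
  ≡ᶜ-reduce []      = ≃⇒≡ (≃-sym (Sumᴾ.∑-zero n (λ t _ → ·ᴾ-zeroˡ (X ^ᴾ t))))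
  ≡ᶜ-reduce (a ∷ p) = begin
    a ∷ p                       ≈⟨ ≃⇒≡ (∷-cong (ℤₚ.+-identityʳ a) ≃-refl) ⟨
    constᴾ a +ᴾ (0ℤ ∷ p)        ≈⟨ ≃⇒≡ (+ᴾ-congˡ (constᴾ a) (X*ᴾ p)) ⟨
    constᴾ a +ᴾ X *ᴾ p          ≈⟨ ≡-+ˡ (constᴾ a) (≡-*ˡ X (≡ᶜ-reduce p)) ⟩
    constᴾ a +ᴾ X *ᴾ reduce p   ≈⟨ reduce-∷ a p ⟨
    reduce (a ∷ p)              ∎
    where open ≡[_]-Reasoning (GenCyc n)

  cycCoeff-complete : ∀ {p q} → (∀ t → t ≤ n′ → cycCoeff t p ≡ cycCoeff t q) → p ≡ᶜ q
  cycCoeff-complete {p} {q} same = begin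
    p          ≈⟨ ≡ᶜ-reduce p ⟩
    reduce p   ≈⟨ ≃⇒≡ (Sumᴾ.∑-cong n (λ t t<n → ≡⇒≃ (cong (_·ᴾ X ^ᴾ t) (same t (ℕₚ.≤-pred t<n))))) ⟩
    reduce q   ≈⟨ ≡ᶜ-reduce q ⟨
    q          ∎
    where open ≡[_]-Reasoning (GenCyc n)

  x^k∘x⁻¹ : ∀ k → (X ^ᴾ k) ∘ᴾ x⁻¹ ≃ x⁻¹ ^ᴾ k
  x^k∘x⁻¹ k = ≃-trans (∘ᴾ-^ X k x⁻¹) (^ᴾ-cong k (∘ᴾ-X x⁻¹))

  σ-≡ᶜ : ∀ {p q} → p ≡ᶜ q → p ∘ᴾ x⁻¹ ≡ᶜ q ∘ᴾ x⁻¹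
  σ-≡ᶜ = ≡-∘ᴾ x⁻¹ (λ {g} → cyclotomic∘x⁻¹ {g})
    where
    cyclotomic∘x⁻¹ : ∀ {g} → GenCyc n g → g ∘ᴾ x⁻¹ ∈ GenCyc n
    cyclotomic∘x⁻¹ {g} g≈P = ∈-resp-≃ (≃-sym g∘x⁻¹≃) (difference∈ x⁻¹ⁿ≡1)
      where
      g∘x⁻¹≃ : g ∘ᴾ x⁻¹ ≃ x⁻¹ ^ᴾ n -ᴾ 1ᴾ
      g∘x⁻¹≃ = begin
        g ∘ᴾ x⁻¹                      ≈⟨ ∘ᴾ-congʳ x⁻¹ (≈ᴾ⇒≃ g (X ^ᴾ n -ᴾ 1ᴾ) g≈P) ⟩
        (X ^ᴾ n -ᴾ 1ᴾ) ∘ᴾ x⁻¹         ≈⟨ ∘ᴾ-- (X ^ᴾ n) 1ᴾ x⁻¹ ⟩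
        (X ^ᴾ n) ∘ᴾ x⁻¹ -ᴾ 1ᴾ ∘ᴾ x⁻¹  ≈⟨ +ᴾ-cong (x^k∘x⁻¹ n) (-ᴾ-cong (∘ᴾ-const (+ 1) x⁻¹)) ⟩
        x⁻¹ ^ᴾ n -ᴾ 1ᴾ                ∎
        where open ≃-Reasoning

  y∘x⁻¹≡y : y ∘ᴾ x⁻¹ ≡ᶜ y
  y∘x⁻¹≡y = begin
    (X +ᴾ X ^ᴾ n′) ∘ᴾ x⁻¹   ≈⟨ ≃⇒≡ (≃-trans (∘ᴾ-+ X (X ^ᴾ n′) x⁻¹) (+ᴾ-cong (∘ᴾ-X x⁻¹) (x^k∘x⁻¹ n′))) ⟩
    x⁻¹ +ᴾ x⁻¹ ^ᴾ n′        ≈⟨ ≡-+ˡ x⁻¹ (^ᴾ-reflect x⁻¹*X≡1 x⁻¹ⁿ≡1 1 (s≤s z≤n)) ⟩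
    x⁻¹ +ᴾ X ^ᴾ 1           ≈⟨ ≃⇒≡ (≃-trans (+ᴾ-congˡ x⁻¹ (*ᴾ-identityʳ X)) (+ᴾ-comm x⁻¹ X)) ⟩
    y                       ∎
    where open ≡[_]-Reasoning (GenCyc n)

  σ-φ : ∀ f → (f ∘ᴾ y) ∘ᴾ x⁻¹ ≡ᶜ f ∘ᴾ y
  σ-φ f = ≡-trans (≃⇒≡ (∘ᴾ-assoc f y x⁻¹)) (∘ᴾ-≡ f y∘x⁻¹≡y)

  cycSuc : ℕ → ℕ
  cycSuc t with t ℕ.≟ n′
  ... | yes _ = zero
  ... | no  _ = suc t

  cycNeg : ℕ → ℕ
  cycNeg zero    = zero
  cycNeg (suc t) = n′ ∸ t

  cycNeg-≡ : ∀ {t} → 1 ≤ t → cycNeg t ≡ n ∸ t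
  cycNeg-≡ {suc t} _ = refl

  cycSuc-≤ : ∀ {t} → t ≤ n′ → cycSuc t ≤ n′
  cycSuc-≤ {t} t≤n′ with t ℕ.≟ n′
  ... | yes _   = z≤n
  ... | no t≢n′ = ℕₚ.≤∧≢⇒< t≤n′ t≢n′

  cycPred-cycSuc : ∀ t → cycPred (cycSuc t) ≡ t
  cycPred-cycSuc t with t ℕ.≟ n′
  ... | yes t≡n′ = ≡.sym t≡n′
  ... | no  _    = refl

  cycNeg-cycSuc : ∀ {t} → t ≤ n′ → cycNeg (cycSuc t) ≡ cycPred (cycNeg t)
  cycNeg-cycSuc {t} t≤n′ with t ℕ.≟ n′
  ... | yes t≡n′ = ≡.sym (cycPred-cycNeg-n′ t t≡n′)
    where
    cycPred-cycNeg-n′ : ∀ t → t ≡ n′ → cycPred (cycNeg t) ≡ 0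
    cycPred-cycNeg-n′ zero    0≡n′ = ≡.sym 0≡n′
    cycPred-cycNeg-n′ (suc t) t+1≡n′ =
      cong cycPred (≡.trans (cong (_∸ t) (≡.sym t+1≡n′)) (ℕₚ.m+n∸n≡m 1 t))
  ... | no t≢n′ = lemma t (ℕₚ.≤∧≢⇒< t≤n′ t≢n′)
    where
    lemma : ∀ t → t < n′ → n′ ∸ t ≡ cycPred (cycNeg t)
    lemma zero    _    = refl
    lemma (suc t) t<n′ = cong cycPred (≡.sym (m∸n≡suc[m∸suc[n]] (ℕₚ.<-trans (ℕₚ.n<1+n t) t<n′)))

  δ₀-cycNeg : ∀ {t} → t ≤ n′ → δ 0 (cycNeg t) ≡ δ 0 t
  δ₀-cycNeg {zero}  _     = refl
  δ₀-cycNeg {suc t} t<n′ = cong (δ 0) (m∸n≡suc[m∸suc[n]] t<n′)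

  cycCoeff-x⁻¹* : ∀ {t} → t ≤ n′ → ∀ q → cycCoeff t (x⁻¹ *ᴾ q) ≡ cycCoeff (cycSuc t) q
  cycCoeff-x⁻¹* {t} t≤n′ q = begin
    cycCoeff t (x⁻¹ *ᴾ q)                     ≡⟨ cong (λ s → cycCoeff s (x⁻¹ *ᴾ q)) (cycPred-cycSuc t) ⟨
    cycCoeff (cycPred (cycSuc t)) (x⁻¹ *ᴾ q)  ≡⟨ cycCoeff-X* (cycSuc t) (x⁻¹ *ᴾ q) ⟨
    cycCoeff (cycSuc t) (X *ᴾ (x⁻¹ *ᴾ q))     ≡⟨ cycCoeff-cong (cycSuc t) (*ᴾ-assoc X x⁻¹ q) ⟨
    cycCoeff (cycSuc t) (X ^ᴾ n *ᴾ q)         ≡⟨ cycCoeff-≡ᶜ (cycSuc-≤ t≤n′) (≡-*ʳ q Xⁿ≡1) ⟩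
    cycCoeff (cycSuc t) (1ᴾ *ᴾ q)             ≡⟨ cycCoeff-cong (cycSuc t) (*ᴾ-identityˡ q) ⟩
    cycCoeff (cycSuc t) q                     ∎
    where open ≡.≡-Reasoning

  cycCoeff-σ : ∀ g {t} → t ≤ n′ → cycCoeff t (g ∘ᴾ x⁻¹) ≡ cycCoeff (cycNeg t) g
  cycCoeff-σ []      _           = refl
  cycCoeff-σ (a ∷ g) {t} t≤n′ = begin
    cycCoeff t (constᴾ a +ᴾ x⁻¹ *ᴾ (g ∘ᴾ x⁻¹))
      ≡⟨ cycCoeff-+ t (constᴾ a) (x⁻¹ *ᴾ (g ∘ᴾ x⁻¹)) ⟩
    cycCoeff t (constᴾ a) ℤ.+ cycCoeff t (x⁻¹ *ᴾ (g ∘ᴾ x⁻¹))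
      ≡⟨ cong₂ ℤ._+_ (≡.trans (cycCoeff-∷ t a []) (ℤₚ.+-identityʳ (δ 0 t ℤ.* a)))
                     (cycCoeff-x⁻¹* t≤n′ (g ∘ᴾ x⁻¹)) ⟩
    δ 0 t ℤ.* a ℤ.+ cycCoeff (cycSuc t) (g ∘ᴾ x⁻¹)
      ≡⟨ cong (λ z → δ 0 t ℤ.* a ℤ.+ z) (cycCoeff-σ g (cycSuc-≤ t≤n′)) ⟩
    δ 0 t ℤ.* a ℤ.+ cycCoeff (cycNeg (cycSuc t)) g
      ≡⟨ cong₂ (λ d s → d ℤ.* a ℤ.+ cycCoeff s g) (δ₀-cycNeg t≤n′) (≡.sym (cycNeg-cycSuc t≤n′)) ⟨
    δ 0 (cycNeg t) ℤ.* a ℤ.+ cycCoeff (cycPred (cycNeg t)) g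
      ≡⟨ cycCoeff-∷ (cycNeg t) a g ⟨
    cycCoeff (cycNeg t) (a ∷ g) ∎
    where open ≡.≡-Reasoning

-- The ideal I

module Halves (n′ c : ℕ) (parity : suc n′ ≡ c + c ⊎ suc n′ ≡ suc (c + c)) where

  open Cyclic n′ public

  c+c≤n : c + c ≤ n
  c+c≤n = [ (λ n≡c+c → ℕₚ.≤-reflexive (≡.sym n≡c+c))
          , (λ n≡1+c+c → ≡.subst (c + c ≤_) (≡.sym n≡1+c+c) (ℕₚ.n≤1+n (c + c))) ]′ parity

  n≤1+c+c : n ≤ suc (c + c)
  n≤1+c+c = [ (λ n≡c+c → ≡.subst (_≤ suc (c + c)) (≡.sym n≡c+c) (ℕₚ.n≤1+n (c + c)))
            , ℕₚ.≤-reflexive ]′ parity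

  c<n : c < n
  c<n = half<n c+c≤n
    where
    half<n : ∀ {m} → m + m ≤ n → m < n
    half<n {zero}  _       = s≤s z≤n
    half<n {suc m} 2m+2≤n = ℕₚ.<-≤-trans (ℕₚ.m<m+n (suc m) (s≤s z≤n)) 2m+2≤n

  c≤n′ : c ≤ n′
  c≤n′ = ℕₚ.≤-pred c<n

  c≤n∸k : ∀ {k} → k ≤ c → c ≤ n ∸ k
  c≤n∸k {k} k≤c = begin
    c             ≡⟨ ℕₚ.m+n∸m≡n c c ⟨
    c + c ∸ c     ≤⟨ ℕₚ.∸-monoʳ-≤ (c + c) k≤c ⟩
    c + c ∸ k     ≤⟨ ℕₚ.∸-monoˡ-≤ k c+c≤n ⟩
    n ∸ k         ∎
    where open ℕₚ.≤-Reasoning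

  n∸k≤c : ∀ {k} → c < k → n ∸ k ≤ c
  n∸k≤c {k} c<k = begin
    n ∸ k             ≤⟨ ℕₚ.∸-monoˡ-≤ k n≤1+c+c ⟩
    suc (c + c) ∸ k   ≤⟨ ℕₚ.∸-monoʳ-≤ (suc (c + c)) c<k ⟩
    suc (c + c) ∸ suc c ≡⟨ ℕₚ.m+n∸m≡n c c ⟩
    c                 ∎
    where open ℕₚ.≤-Reasoning

  α β : ℕ
  α = suc c
  β = n ∸ suc c

  α+β≡n : α + β ≡ n
  α+β≡n = ℕₚ.m+[n∸m]≡n c<n

  D : Poly
  D = ψ α -ᴾ ψ β

  infix 4 _≡ᴰ_ _≡ᴵ_

  _≡ᴰ_ : Poly → Poly → Set
  p ≡ᴰ q = p ≡[ _≈ᴾ D ] q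

  _≡ᴵ_ : Poly → Poly → Set
  p ≡ᴵ q = p ≡[ GenI n ] q

  private
    Reflected : ℕ → Set
    Reflected j = ψ j ≡ᴰ ψ (n ∸ j)

    reflected-α : Reflected α
    reflected-α = ≡-by (generator∈ (λ _ → refl))

    reflected-c : Reflected c
    reflected-c = [ even , odd ]′ parity
      where
      even : n ≡ c + c → Reflected c
      even n≡c+c = ≡.subst (λ m → ψ c ≡ᴰ ψ m) (≡.sym n∸c≡c) (≡-refl {p = ψ c})
        where n∸c≡c = ≡.trans (cong (_∸ c) n≡c+c) (ℕₚ.m+n∸m≡n c c)
      odd : n ≡ suc (c + c) → Reflected c
      odd n≡1+c+c = ≡.subst₂ (λ a b → ψ a ≡ᴰ ψ b) β≡c (≡.sym n∸c≡α) (≡-sym reflected-α)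
        where
        β≡c = ≡.trans (cong (_∸ suc c) n≡1+c+c) (ℕₚ.m+n∸m≡n c c)
        n∸c≡α = ≡.trans (m∸n≡suc[m∸suc[n]] c<n) (cong suc β≡c)

    reflected-step : ∀ {j} → suc (suc j) ≤ n → Reflected j → Reflected (suc j) → Reflected (suc (suc j))
    reflected-step {j} j+2≤n ψj≡ ψj+1≡ = begin
      X *ᴾ ψ (suc j) -ᴾ ψ j
        ≈⟨ ≡-+ (≡-*ˡ X (≡.subst (λ m → ψ (suc j) ≡ᴰ ψ m) n∸[j+1]≡ ψj+1≡))
               (≡--ᴾ (≡.subst (λ m → ψ j ≡ᴰ ψ m) n∸j≡ ψj≡)) ⟩
      X *ᴾ ψ (suc k) -ᴾ ψ (suc (suc k))
        ≈⟨ ≃⇒≡ (+ᴾ-congʳ _ (ψ-rec k)) ⟩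
      (ψ (suc (suc k)) +ᴾ ψ k) -ᴾ ψ (suc (suc k))
        ≈⟨ ≃⇒≡ (cancel (ψ (suc (suc k))) (ψ k)) ⟩
      ψ k ∎
      where
      open ≡[_]-Reasoning (_≈ᴾ D)
      k = n ∸ suc (suc j)
      n∸[j+1]≡ : n ∸ suc j ≡ suc k
      n∸[j+1]≡ = m∸n≡suc[m∸suc[n]] j+2≤n
      n∸j≡ : n ∸ j ≡ suc (suc k)
      n∸j≡ = ≡.trans (m∸n≡suc[m∸suc[n]] (ℕₚ.<-trans (ℕₚ.n<1+n j) j+2≤n)) (cong suc n∸[j+1]≡)
      cancel : ∀ p q → (p +ᴾ q) -ᴾ p ≃ q
      cancel = solve-∀ ℤ[t]ᴬ

    reflected : ∀ j → c ≤ j → j ≤ n → Reflected j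
    reflected j c≤j j≤n with ℕₚ.m≤n⇒m<n∨m≡n c≤j
    ... | inj₂ refl = reflected-c
    ... | inj₁ c<j with ℕₚ.m≤n⇒m<n∨m≡n c<j
    ...   | inj₂ refl = reflected-α
    reflected (suc (suc j)) _ j+2≤n | inj₁ _ | inj₁ (s≤s (s≤s c≤j)) =
      reflected-step j+2≤n (reflected j c≤j (ℕₚ.≤-trans (ℕₚ.n≤1+n _) j+1≤n))
                           (reflected (suc j) (ℕₚ.m≤n⇒m≤1+n c≤j) j+1≤n)
      where j+1≤n = ℕₚ.≤-trans (ℕₚ.n≤1+n _) j+2≤n

  ψ-reflect-D : ∀ j → j ≤ n → ψ (n ∸ j) ≡ᴰ ψ j
  ψ-reflect-D j j≤n with ℕₚ.≤-total c j
  ... | inj₁ c≤j = ≡-sym (reflected j c≤j j≤n)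
  ... | inj₂ j≤c =
    ≡.subst (λ m → ψ (n ∸ j) ≡ᴰ ψ m) (ℕₚ.m∸[m∸n]≡n j≤n) (reflected (n ∸ j) (c≤n∸k j≤c) (ℕₚ.m∸n≤m n j))

  ψ-translate-D : ∀ k → ψ (k + n) ≡ᴰ ψ k
  ψ-translate-D zero          = ψ-reflect-D 0 z≤n
  ψ-translate-D (suc zero)    = begin
    X *ᴾ ψ n -ᴾ ψ n′       ≈⟨ ≡-+ (≡-*ˡ X (ψ-translate-D 0)) (≡--ᴾ ψn′≡ψ1) ⟩
    X *ᴾ ψ 0 -ᴾ ψ 1        ≈⟨ ≃⇒≡ (two-minus-one X) ⟩
    ψ 1                    ∎
    where
    open ≡[_]-Reasoning (_≈ᴾ D)
    ψn′≡ψ1 : ψ n′ ≡ᴰ ψ 1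
    ψn′≡ψ1 = ≡-sym (≡.subst (λ m → ψ m ≡ᴰ ψ n′) (ℕₚ.m+n∸n≡m 1 n′) (ψ-reflect-D n′ (ℕₚ.n≤1+n n′)))
    two-minus-one : ∀ x → x *ᴾ constᴾ (+ 2) -ᴾ x ≃ x
    two-minus-one = solve-∀ ℤ[t]ᴬ
  ψ-translate-D (suc (suc k)) = ≡-+ (≡-*ˡ X (ψ-translate-D (suc k))) (≡--ᴾ (ψ-translate-D k))

  ψ-≡ᴰ-isEquivalence : IsEquivalence (λ a b → ψ a ≡ᴰ ψ b)
  ψ-≡ᴰ-isEquivalence = record { refl = λ {a} → ≡-refl {p = ψ a} ; sym = ≡-sym ; trans = ≡-trans }

  module D-Closure = ≡±-Closure n (λ a b → ψ a ≡ᴰ ψ b) ψ-≡ᴰ-isEquivalence ψ-translate-D ψ-reflect-D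

  -- ψ₀ is not a generator (the indices of generators are ≥ 1), but the
  -- recurrence writes ψₙ − ψ₀ as x (ψₙ₊₁ − ψ₁) − (ψₙ₊₂ − ψ₂).
  ψₙ-ψ₀∈I : ψ n -ᴾ ψ 0 ∈ GenI n
  ψₙ-ψ₀∈I = ∈-resp-≃ (recurrence X (ψ (suc n)) (ψ n) (ψ 0))
                     (∈-+ (∈-* X (generator∈ {g = ψ (suc n) -ᴾ ψ 1} (translate 0)))
                          (∈--ᴾ (generator∈ {g = ψ (2 + n) -ᴾ ψ 2} (translate 1))))
    where
    translate : ∀ b → GenI n (ψ (suc b + n) -ᴾ ψ (suc b))
    translate b = suc b + n , suc b , s≤s z≤n , s≤s z≤n ,
      ≡.subst (λ m → (suc b + m) ≡± suc b mod n) (ℕₚ.*-identityˡ n) (≡±-translate n (suc b) 1) ,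
      (λ _ → refl)
    recurrence : ∀ x a m z → x *ᴾ (a -ᴾ x) +ᴾ (-ᴾ ((x *ᴾ a -ᴾ m) -ᴾ (x *ᴾ x -ᴾ z))) ≃ m -ᴾ z
    recurrence = solve-∀ ℤ[t]ᴬ

  D∈I : D ∈ GenI n
  D∈I with β ℕ.≟ 0
  ... | yes β≡0 = ∈-resp-≃ (+ᴾ-cong (ψ-≡ n≡α) (-ᴾ-cong (ψ-≡ (≡.sym β≡0)))) ψₙ-ψ₀∈I
    where n≡α = ≡.trans (≡.sym α+β≡n) (≡.trans (cong (λ m → α + m) β≡0) (ℕₚ.+-identityʳ α))
  ... | no β≢0 =
    generator∈ (α , β , s≤s z≤n , ℕₚ.n≢0⇒n>0 β≢0 , ≡±-complement {a = α} {b = β} α+β≡n , (λ _ → refl))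

  ⟨D⟩⊆I : ∀ {g} → g ≈ᴾ D → g ∈ GenI n
  ⟨D⟩⊆I {g} g≈D = ∈-resp-≃ (≃-sym (≈ᴾ⇒≃ g D g≈D)) D∈I

  I⊆⟨D⟩ : ∀ {g} → GenI n g → g ∈ (_≈ᴾ D)
  I⊆⟨D⟩ {g} (a , b , _ , _ , a≡±b , g≈) =
    ∈-resp-≃ (≃-sym (≈ᴾ⇒≃ g (ψ a -ᴾ ψ b) g≈)) (difference∈ (D-Closure.≡±⇒~ {a} {b} a≡±b))

  ≡ᴰ⇒≡ᴵ : ∀ {p q} → p ≡ᴰ q → p ≡ᴵ q
  ≡ᴰ⇒≡ᴵ = ≡-mono (λ {g} → ⟨D⟩⊆I {g})

  ψ-reflect : ∀ j → j ≤ n → ψ (n ∸ j) ≡ᴵ ψ j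
  ψ-reflect j j≤n = ≡ᴰ⇒≡ᴵ (ψ-reflect-D j j≤n)

  ψ-% : ∀ k → ψ k ≡ᴵ ψ (k % n)
  ψ-% k = ≡ᴰ⇒≡ᴵ (D-Closure.~-% k)

  φ-≡ᴵ : ∀ {f g} → f ≡ᴵ g → f ∘ᴾ y ≡ᶜ g ∘ᴾ y
  φ-≡ᴵ = ≡-∘ᴾ y (λ {h} → generator∘y {h})
    where
    generator∘y : ∀ {h} → GenI n h → h ∘ᴾ y ∈ GenCyc n
    generator∘y {h} (a , b , _ , _ , a≡±b , h≈) =
      ∈-resp-≃ (≃-sym (≃-trans (∘ᴾ-congʳ y (≈ᴾ⇒≃ h (ψ a -ᴾ ψ b) h≈)) (∘ᴾ-- (ψ a) (ψ b) y)))
               (difference∈ (φ-ψ-≡± {a} {b} a≡±b))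

  -- A spanning set of ℤ[y]/I

  basis : ℕ → Poly
  basis zero    = 1ᴾ
  basis (suc k) = ψ (suc k)

  lincomb : (ℕ → ℤ) → Poly
  lincomb s = ∑ᴾ[ k < suc c ] s k ·ᴾ basis k

  lincomb-zero : ∀ s → (∀ k → k ≤ c → s k ≡ 0ℤ) → lincomb s ≃ []
  lincomb-zero s s≡0 = Sumᴾ.∑-zero (suc c) (λ k k≤c →
    ≃-trans (≡⇒≃ (cong (_·ᴾ basis k) (s≡0 k (ℕₚ.≤-pred k≤c)))) (·ᴾ-zeroˡ (basis k)))

  Spanned : Poly → Set
  Spanned f = Σ (ℕ → ℤ) λ s → f ≡ᴵ lincomb s

  spanned-resp : ∀ {f g} → f ≡ᴵ g → Spanned g → Spanned f
  spanned-resp f≡g (s , g≡) = s , ≡-trans f≡g g≡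

  spanned-+ : ∀ {f g} → Spanned f → Spanned g → Spanned (f +ᴾ g)
  spanned-+ (s , f≡) (t , g≡) =
    (λ k → s k ℤ.+ t k) , ≡-trans (≡-+ f≡ g≡) (≃⇒≡ (≃-sym lincomb-+))
    where
    lincomb-+ : lincomb (λ k → s k ℤ.+ t k) ≃ lincomb s +ᴾ lincomb t
    lincomb-+ = ≃-trans (Sumᴾ.∑-cong (suc c) (λ k _ → ·ᴾ-distribʳ (s k) (t k) (basis k)))
                        (Sumᴾ.∑-distrib (suc c) _ _)

  spanned-· : ∀ a {f} → Spanned f → Spanned (a ·ᴾ f)
  spanned-· a (s , f≡) = (λ k → a ℤ.* s k) , ≡-trans (≡-· a f≡) (≃⇒≡ (≃-sym lincomb-·))
    where
    lincomb-· : lincomb (λ k → a ℤ.* s k) ≃ a ·ᴾ lincomb s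
    lincomb-· = ≃-sym (≃-trans
      (homo-∑ ℤ[t]⁺ ℤ[t]⁺
              (a ·ᴾ_) ≃-refl (·ᴾ-distribˡ a) (suc c) _)
      (Sumᴾ.∑-cong (suc c) (λ k _ → ·ᴾ-assoc a (s k) (basis k))))

  spanned-∑ : ∀ j {F} → (∀ k → k < j → Spanned (F k)) → Spanned (∑ᴾ j F)
  spanned-∑ zero    _       = (λ _ → 0ℤ) , ≃⇒≡ (≃-sym (lincomb-zero _ (λ _ _ → refl)))
  spanned-∑ (suc j) spanF = spanned-+ (spanned-∑ j (weaken< spanF)) (spanF j ℕₚ.≤-refl)

  spanned-basis : ∀ {j} → j ≤ c → Spanned (basis j)
  spanned-basis {j} j≤c = δ j , ≃⇒≡ (≃-sym (≃-trans
    (Sumᴾ.∑-single (suc c) j (s≤s j≤c) other-terms)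
    (≃-trans (≡⇒≃ (cong (_·ᴾ basis j) (δ-refl j))) (·ᴾ-identityˡ (basis j)))))
    where
    other-terms : ∀ k → k < suc c → k ≢ j → δ j k ·ᴾ basis k ≃ []
    other-terms k _ k≢j = ≃-trans (≡⇒≃ (cong (_·ᴾ basis k) (δ-≢ (≡.≢-sym k≢j)))) (·ᴾ-zeroˡ (basis k))

  spanned-ψ-≤c : ∀ {j} → j ≤ c → Spanned (ψ j)
  spanned-ψ-≤c {zero}  _   = spanned-+ (spanned-basis z≤n) (spanned-basis z≤n)
  spanned-ψ-≤c {suc j} j<c = spanned-basis j<c

  spanned-ψ : ∀ k → Spanned (ψ k)
  spanned-ψ k = spanned-resp (ψ-% k) (below-n (m%n<n k n))
    where
    below-n : ∀ {r} → r < n → Spanned (ψ r)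
    below-n {r} r<n with r ℕₚ.≤? c
    ... | yes r≤c = spanned-ψ-≤c r≤c
    ... | no  r≰c =
      spanned-resp (≡-sym (ψ-reflect r (ℕₚ.<⇒≤ r<n))) (spanned-ψ-≤c (n∸k≤c (ℕₚ.≰⇒> r≰c)))

  spanned-X*basis : ∀ k → Spanned (X *ᴾ basis k)
  spanned-X*basis zero    = spanned-resp (≃⇒≡ (*ᴾ-identityʳ X)) (spanned-ψ 1)
  spanned-X*basis (suc k) = spanned-resp (≃⇒≡ (ψ-rec k)) (spanned-+ (spanned-ψ (suc (suc k))) (spanned-ψ k))

  spanned : ∀ f → Spanned f
  spanned []      = spanned-∑ 0 {λ _ → []} (λ _ ())
  spanned (a ∷ p) = spanned-resp (≃⇒≡ a∷p≃) (spanned-+ (spanned-· a (spanned-basis z≤n)) X*p-spanned)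
    where
    a∷p≃ : a ∷ p ≃ a ·ᴾ 1ᴾ +ᴾ X *ᴾ p
    a∷p≃ = ≃-sym (≃-trans (+ᴾ-cong (·ᴾ-1ᴾ a) (X*ᴾ p)) (∷-cong (ℤₚ.+-identityʳ a) ≃-refl))
    s = proj₁ (spanned p)
    X*p-spanned : Spanned (X *ᴾ p)
    X*p-spanned = spanned-resp (≡-*ˡ X (proj₂ (spanned p)))
      (spanned-resp (≃⇒≡ (homo-∑ ℤ[t]⁺ ℤ[t]⁺
                                  (X *ᴾ_) (*ᴾ-zeroʳ X) (*ᴾ-distribˡ X) (suc c) _))
        (spanned-∑ (suc c) (λ k _ → spanned-resp (≃⇒≡ (*ᴾ-·ᴾ-comm (s k) X (basis k)))
                                                  (spanned-· (s k) (spanned-X*basis k)))))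

  cycCoeff-φ-basis : ∀ {k t} → k ≤ n′ → t ≤ n′ → cycCoeff t (basis k ∘ᴾ y) ≡ δ k t ℤ.+ δ (n ∸ k) t
  cycCoeff-φ-basis {zero}  {t} _     t≤n′ = begin
    cycCoeff t (1ᴾ ∘ᴾ y)   ≡⟨ cycCoeff-cong t (∘ᴾ-const (+ 1) y) ⟩
    cycCoeff t (X ^ᴾ 0)    ≡⟨ cycCoeff-X^ z≤n t≤n′ ⟩
    δ 0 t                  ≡⟨ ℤₚ.+-identityʳ (δ 0 t) ⟨
    δ 0 t ℤ.+ 0ℤ           ≡⟨ cong (λ d → δ 0 t ℤ.+ d) (δ-≢ n≢t) ⟨
    δ 0 t ℤ.+ δ n t        ∎
    where
    open ≡.≡-Reasoning
    n≢t : n ≢ t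
    n≢t n≡t = ℕₚ.<⇒≱ (s≤s t≤n′) (ℕₚ.≤-reflexive n≡t)
  cycCoeff-φ-basis {suc k} {t} k<n′ t≤n′ = begin
    cycCoeff t (ψ (suc k) ∘ᴾ y)
      ≡⟨ cycCoeff-≡ᶜ t≤n′ (φ-ψ (suc k)) ⟩
    cycCoeff t (X ^ᴾ suc k +ᴾ x⁻¹ ^ᴾ suc k)
      ≡⟨ cycCoeff-≡ᶜ t≤n′ (≡-+ˡ (X ^ᴾ suc k) (≡-sym (xⁿ⁻ʲ≡x⁻ʲ (suc k) (ℕₚ.<⇒≤ (s≤s k<n′))))) ⟩
    cycCoeff t (X ^ᴾ suc k +ᴾ X ^ᴾ (n ∸ suc k))
      ≡⟨ cycCoeff-+ t (X ^ᴾ suc k) (X ^ᴾ (n ∸ suc k)) ⟩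
    cycCoeff t (X ^ᴾ suc k) ℤ.+ cycCoeff t (X ^ᴾ (n ∸ suc k))
      ≡⟨ cong₂ ℤ._+_ (cycCoeff-X^ k<n′ t≤n′) (cycCoeff-X^ (ℕₚ.m∸n≤m n′ k) t≤n′) ⟩
    δ (suc k) t ℤ.+ δ (n ∸ suc k) t ∎
    where open ≡.≡-Reasoning

  -- The trace form

  -- The constant term of φ f, i.e. Tr(φ f)/n for the trace of ℤ[x]/(xⁿ − 1) over ℤ.
  trace : Poly → ℤ
  trace f = cycCoeff 0 (f ∘ᴾ y)

  trace-cong : ∀ {f g} → f ≃ g → trace f ≡ trace g
  trace-cong f≃g = cycCoeff-cong 0 (∘ᴾ-congʳ y f≃g)

  trace-≡ᴵ : ∀ {f g} → f ≡ᴵ g → trace f ≡ trace g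
  trace-≡ᴵ f≡g = cycCoeff-≡ᶜ z≤n (φ-≡ᴵ f≡g)

  trace-+ : ∀ f g → trace (f +ᴾ g) ≡ trace f ℤ.+ trace g
  trace-+ f g = ≡.trans (cycCoeff-cong 0 (∘ᴾ-+ f g y)) (cycCoeff-+ 0 (f ∘ᴾ y) (g ∘ᴾ y))

  trace-· : ∀ a f → trace (a ·ᴾ f) ≡ a ℤ.* trace f
  trace-· a f = ≡.trans (cycCoeff-cong 0 (∘ᴾ-· a f y)) (cycCoeff-· 0 a (f ∘ᴾ y))

  trace-ψ : ∀ {m} → 1 ≤ m → m ≤ n′ → trace (ψ m) ≡ 0ℤ
  trace-ψ {suc m} _ m<n′ = ≡.trans (cycCoeff-φ-basis m<n′ z≤n)
    (cong (λ d → 0ℤ ℤ.+ δ d 0) (m∸n≡suc[m∸suc[n]] m<n′))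

  trace-ψ₀ : trace (ψ 0) ≡ + 2
  trace-ψ₀ = cycCoeff-cong 0 (∘ᴾ-const (+ 2) y)

  trace-ψₙ : trace (ψ n) ≡ + 2
  trace-ψₙ = cycCoeff-≡ᶜ z≤n (≡-trans (φ-ψ n) (≡-+ Xⁿ≡1 x⁻¹ⁿ≡1))

  gram : ℕ → ℕ → ℤ
  gram j k = trace (basis j *ᴾ basis k)

  private
    distinct-sum≤n′ : ∀ {j k} → k < j → j ≤ c → j + k ≤ n′
    distinct-sum≤n′ {j} {k} k<j j≤c = ℕₚ.≤-pred (begin-strict
      j + k   <⟨ ℕₚ.+-monoʳ-< j (ℕₚ.<-≤-trans k<j j≤c) ⟩
      j + c   ≤⟨ ℕₚ.+-monoˡ-≤ c j≤c ⟩
      c + c   ≤⟨ c+c≤n ⟩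
      n       ∎)
      where open ℕₚ.≤-Reasoning

    trace-ψ*ψ : ∀ {j k} → 1 ≤ k → k < j → j ≤ c → trace (ψ j *ᴾ ψ k) ≡ 0ℤ
    trace-ψ*ψ {j} {k} 1≤k k<j j≤c = begin
      trace (ψ j *ᴾ ψ k)                       ≡⟨ trace-cong (ψ-*-ψ (ℕₚ.<⇒≤ k<j)) ⟩
      trace (ψ (j + k) +ᴾ ψ (j ∸ k))           ≡⟨ trace-+ (ψ (j + k)) (ψ (j ∸ k)) ⟩
      trace (ψ (j + k)) ℤ.+ trace (ψ (j ∸ k))  ≡⟨ cong₂ ℤ._+_ (trace-ψ 1≤j+k j+k≤n′) (trace-ψ 1≤j∸k j∸k≤n′) ⟩
      0ℤ                                       ∎
      where
      open ≡.≡-Reasoning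
      1≤j+k = ℕₚ.≤-trans 1≤k (ℕₚ.m≤n+m k j)
      1≤j∸k = ℕₚ.m<n⇒0<n∸m k<j
      j∸k≤n′ = ℕₚ.≤-trans (ℕₚ.m∸n≤m j k) (ℕₚ.≤-trans j≤c c≤n′)
      j+k≤n′ = distinct-sum≤n′ k<j j≤c

  gram-orthogonal : ∀ {j k} → j ≤ c → k ≤ c → j ≢ k → gram j k ≡ 0ℤ
  gram-orthogonal {zero}  {zero}  _   _   0≢0 = ⊥-elim (0≢0 refl)
  gram-orthogonal {zero}  {suc k} _   k≤c _   =
    ≡.trans (trace-cong (*ᴾ-identityˡ (ψ (suc k)))) (trace-ψ (s≤s z≤n) (ℕₚ.≤-trans k≤c c≤n′))
  gram-orthogonal {suc j} {zero}  j≤c _   _   =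
    ≡.trans (trace-cong (*ᴾ-identityʳ (ψ (suc j)))) (trace-ψ (s≤s z≤n) (ℕₚ.≤-trans j≤c c≤n′))
  gram-orthogonal {suc j} {suc k} j≤c k≤c j≢k with ℕₚ.<-cmp j k
  ... | tri< j<k _ _ =
    ≡.trans (trace-cong (*ᴾ-comm (ψ (suc j)) (ψ (suc k)))) (trace-ψ*ψ (s≤s z≤n) (s≤s j<k) k≤c)
  ... | tri≈ _ j≡k _ = ⊥-elim (j≢k (cong suc j≡k))
  ... | tri> _ _ k<j = trace-ψ*ψ (s≤s z≤n) (s≤s k<j) j≤c

  trace-ψ² : ∀ j → trace (ψ j *ᴾ ψ j) ≡ trace (ψ (j + j)) ℤ.+ + 2
  trace-ψ² j = begin
    trace (ψ j *ᴾ ψ j)                        ≡⟨ trace-cong (ψ-*-ψ {j} ℕₚ.≤-refl) ⟩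
    trace (ψ (j + j) +ᴾ ψ (j ∸ j))            ≡⟨ trace-+ (ψ (j + j)) (ψ (j ∸ j)) ⟩
    trace (ψ (j + j)) ℤ.+ trace (ψ (j ∸ j))   ≡⟨ cong (λ m → trace (ψ (j + j)) ℤ.+ trace (ψ m)) (ℕₚ.n∸n≡0 j) ⟩
    trace (ψ (j + j)) ℤ.+ trace (ψ 0)         ≡⟨ cong (λ t → trace (ψ (j + j)) ℤ.+ t) trace-ψ₀ ⟩
    trace (ψ (j + j)) ℤ.+ + 2                 ∎
    where open ≡.≡-Reasoning

  gram-positive : ∀ {j} → j ≤ c → Σ ℕ λ w → gram j j ≡ + suc w
  gram-positive {zero}  _   = 0 , ≡.trans (trace-cong (*ᴾ-identityˡ 1ᴾ)) (cycCoeff-φ-basis {0} z≤n z≤n)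
  gram-positive {suc j} j<c with suc j + suc j ℕ.≟ n
  ... | yes 2j≡n =
    3 , ≡.trans (trace-ψ² (suc j)) (cong (ℤ._+ + 2) (≡.trans (cong (λ m → trace (ψ m)) 2j≡n) trace-ψₙ))
  ... | no  2j≢n =
    1 , ≡.trans (trace-ψ² (suc j)) (cong (ℤ._+ + 2) (trace-ψ (s≤s z≤n) (ℕₚ.≤-pred (ℕₚ.≤∧≢⇒< 2j≤n 2j≢n))))
    where 2j≤n = ℕₚ.≤-trans (ℕₚ.+-mono-≤ j<c j<c) c+c≤n

  trace-lincomb-* : ∀ s g → trace (lincomb s *ᴾ g) ≡ ∑ℤ[ j < suc c ] s j ℤ.* trace (basis j *ᴾ g)
  trace-lincomb-* s g = ≡.trans
    (homo-∑ ℤ[t]⁺ ℤₚ.+-0-commutativeMonoid (λ f → trace (f *ᴾ g)) refl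
            (λ f₁ f₂ → ≡.trans (trace-cong (*ᴾ-distribʳ g f₁ f₂)) (trace-+ (f₁ *ᴾ g) (f₂ *ᴾ g))) (suc c) _)
    (Sumℤ.∑-cong (suc c) (λ j _ →
      ≡.trans (trace-cong (·ᴾ-*ᴾ-assoc (s j) (basis j) g)) (trace-· (s j) (basis j *ᴾ g))))

  trace-lincomb-basis : ∀ s {k} → k ≤ c → trace (lincomb s *ᴾ basis k) ≡ s k ℤ.* gram k k
  trace-lincomb-basis s {k} k≤c = ≡.trans (trace-lincomb-* s (basis k))
    (Sumℤ.∑-single (suc c) k (s≤s k≤c) (λ j j≤c j≢k →
      ≡.trans (cong (s j ℤ.*_) (gram-orthogonal (ℕₚ.≤-pred j≤c) k≤c j≢k)) (ℤₚ.*-zeroʳ (s j))))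

  trace-lincomb² : ∀ s → trace (lincomb s *ᴾ lincomb s) ≡ ∑ℤ[ k < suc c ] s k ℤ.* (s k ℤ.* gram k k)
  trace-lincomb² s = ≡.trans (trace-lincomb-* s (lincomb s)) (Sumℤ.∑-cong (suc c) (λ k k≤c → cong (s k ℤ.*_)
    (≡.trans (trace-cong (*ᴾ-comm (basis k) (lincomb s))) (trace-lincomb-basis s (ℕₚ.≤-pred k≤c)))))

  trace-square≡0⇒∈I : ∀ f → trace (f *ᴾ f) ≡ 0ℤ → f ∈ GenI n
  trace-square≡0⇒∈I f trace≡0 = ≡[]⇒∈ (≡-trans f≡ (≃⇒≡ (lincomb-zero s s≡0)))
    where
    s = proj₁ (spanned f)
    f≡ = proj₂ (spanned f)
    ∑≡0 : ∑ℤ[ k < suc c ] s k ℤ.* (s k ℤ.* gram k k) ≡ 0ℤ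
    ∑≡0 = ≡.trans (≡.sym (trace-lincomb² s)) (≡.trans (≡.sym (trace-≡ᴵ (≡-* f≡ f≡))) trace≡0)
    nonneg : ∀ k → k < suc c → 0ℤ ℤ.≤ s k ℤ.* (s k ℤ.* gram k k)
    nonneg k k≤c with gram-positive (ℕₚ.≤-pred k≤c)
    ... | w , gram≡ = ≡.subst (λ g → 0ℤ ℤ.≤ s k ℤ.* (s k ℤ.* g)) (≡.sym gram≡) (0≤weighted-square (s k) w)
    s≡0 : ∀ k → k ≤ c → s k ≡ 0ℤ
    s≡0 k k≤c with gram-positive k≤c
    ... | w , gram≡ = weighted-square≡0 (s k) w
      (≡.subst (λ g → s k ℤ.* (s k ℤ.* g) ≡ 0ℤ) gram≡ (∑ℤ-nonneg-≡0 (suc c) nonneg ∑≡0 k (s≤s k≤c)))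

  ∈I⇒trace≡0 : ∀ {f} → f ∈ GenI n → trace f ≡ 0ℤ
  ∈I⇒trace≡0 f∈I = trace-≡ᴵ (∈⇒≡[] f∈I)

  torsion-free : ∀ a f → a ≢ 0ℤ → a ·ᴾ f ∈ GenI n → f ∈ GenI n
  torsion-free a f a≢0 af∈I = trace-square≡0⇒∈I f (cancel (ℤₚ.i*j≡0⇒i≡0∨j≡0 a a²t≡0))
    where
    a²t≡0 : a ℤ.* (a ℤ.* trace (f *ᴾ f)) ≡ 0ℤ
    a²t≡0 = begin
      a ℤ.* (a ℤ.* trace (f *ᴾ f))   ≡⟨ cong (a ℤ.*_) (trace-· a (f *ᴾ f)) ⟨
      a ℤ.* trace (a ·ᴾ (f *ᴾ f))    ≡⟨ trace-· a (a ·ᴾ (f *ᴾ f)) ⟨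
      trace (a ·ᴾ (a ·ᴾ (f *ᴾ f)))   ≡⟨ trace-cong (≃-trans (·ᴾ-*ᴾ-assoc a f (a ·ᴾ f)) (·ᴾ-cong a (*ᴾ-·ᴾ-comm a f f))) ⟨
      trace ((a ·ᴾ f) *ᴾ (a ·ᴾ f))   ≡⟨ ∈I⇒trace≡0 (∈-* (a ·ᴾ f) af∈I) ⟩
      0ℤ                             ∎
      where open ≡.≡-Reasoning
    cancel : a ≡ 0ℤ ⊎ a ℤ.* trace (f *ᴾ f) ≡ 0ℤ → trace (f *ᴾ f) ≡ 0ℤ
    cancel (inj₁ a≡0)  = ⊥-elim (a≢0 a≡0)
    cancel (inj₂ at≡0) with ℤₚ.i*j≡0⇒i≡0∨j≡0 a at≡0
    ... | inj₁ a≡0 = ⊥-elim (a≢0 a≡0)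
    ... | inj₂ t≡0 = t≡0

  reduced² : ∀ {f} → f *ᴾ f ∈ GenI n → f ∈ GenI n
  reduced² {f} f²∈I = trace-square≡0⇒∈I f (∈I⇒trace≡0 f²∈I)

  reduced : ∀ f k → f ^ᴾ k ∈ GenI n → f ∈ GenI n
  reduced f zero    1∈I = ∈-resp-≃ (*ᴾ-identityʳ f) (∈-* f 1∈I)
  reduced f (suc k)     = descend k
    where
    descend : ∀ k → f ^ᴾ suc k ∈ GenI n → f ∈ GenI n
    descend zero    f¹∈I   = ∈-resp-≃ (*ᴾ-identityʳ f) f¹∈I
    descend (suc k) fᵏ⁺²∈I =
      descend k (reduced² (∈-resp-≃ (regroup f (f ^ᴾ k)) (∈-* (f ^ᴾ k) fᵏ⁺²∈I)))
      where
      regroup : ∀ f g → g *ᴾ (f *ᴾ (f *ᴾ g)) ≃ (f *ᴾ g) *ᴾ (f *ᴾ g)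
      regroup = solve-∀ ℤ[t]ᴬ

  φ-injective : ∀ f g → f ∘ᴾ y ≡ᶜ g ∘ᴾ y → f -ᴾ g ∈ GenI n
  φ-injective f g φf≡φg = trace-square≡0⇒∈I h (cycCoeff-≡ᶜ z≤n φh²≡0)
    where
    h = f -ᴾ g
    φh≡0 : h ∘ᴾ y ≡ᶜ []
    φh≡0 = ≡-trans (≃⇒≡ (∘ᴾ-- f g y))
                   (≡-trans (≡-+ʳ (-ᴾ (g ∘ᴾ y)) φf≡φg) (≃⇒≡ (+ᴾ-inverseʳ (g ∘ᴾ y))))
    φh²≡0 : (h *ᴾ h) ∘ᴾ y ≡ᶜ []
    φh²≡0 = ≡-trans (≃⇒≡ (∘ᴾ-* h h y)) (≡-* φh≡0 φh≡0)

  -- The radical of (ψₙ − 2)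

  private
    e : ℕ
    e = α ∸ β

    β≤α : β ≤ α
    β≤α = ℕₚ.m≤n⇒m≤1+n (n∸k≤c (ℕₚ.n<1+n c))

    e≤n : e ≤ n
    e≤n = ℕₚ.≤-trans (ℕₚ.m∸n≤m α β) c<n

    α+α≡n+e : α + α ≡ n + e
    α+α≡n+e = begin
      α + α           ≡⟨ cong (λ m → α + m) (ℕₚ.m+[n∸m]≡n β≤α) ⟨
      α + (β + e)     ≡⟨ ℕₚ.+-assoc α β e ⟨
      α + β + e       ≡⟨ cong (_+ e) α+β≡n ⟩
      n + e           ∎
      where open ≡.≡-Reasoning

    β+β≡n∸e : β + β ≡ n ∸ e
    β+β≡n∸e = begin
      β + β               ≡⟨ ℕₚ.m+n∸n≡m (β + β) e ⟨
      β + β + e ∸ e       ≡⟨ cong (_∸ e) (reorder β e) ⟩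
      β + e + β ∸ e       ≡⟨ cong (λ m → m + β ∸ e) (ℕₚ.m+[n∸m]≡n β≤α) ⟩
      α + β ∸ e           ≡⟨ cong (_∸ e) α+β≡n ⟩
      n ∸ e               ∎
      where
      open ≡.≡-Reasoning
      reorder : ∀ b e → b + b + e ≡ b + e + b
      reorder = ℕ-solve-∀

  D² : D *ᴾ D ≃ (ψ n -ᴾ ψ 0) *ᴾ (ψ e -ᴾ ψ 0)
  D² = begin
    (ψ α -ᴾ ψ β) *ᴾ (ψ α -ᴾ ψ β)
      ≈⟨ square-of-difference (ψ α) (ψ β) ⟩
    (ψ α *ᴾ ψ α +ᴾ ψ β *ᴾ ψ β) -ᴾ (ψ α *ᴾ ψ β +ᴾ ψ α *ᴾ ψ β)
      ≈⟨ +ᴾ-cong (+ᴾ-cong ψα² ψβ²) (-ᴾ-cong (+ᴾ-cong ψαψβ ψαψβ)) ⟩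
    ((ψ (n + e) +ᴾ ψ 0) +ᴾ (ψ (n ∸ e) +ᴾ ψ 0)) -ᴾ ((ψ n +ᴾ ψ e) +ᴾ (ψ n +ᴾ ψ e))
      ≈⟨ rearrange (ψ (n + e)) (ψ (n ∸ e)) (ψ n) (ψ e) ⟩
    (ψ (n + e) +ᴾ ψ (n ∸ e)) -ᴾ ψ 0 *ᴾ ψ n -ᴾ ψ 0 *ᴾ ψ e +ᴾ ψ 0 *ᴾ ψ 0
      ≈⟨ +ᴾ-congʳ _ (+ᴾ-congʳ _ (+ᴾ-congʳ _ (ψ-*-ψ e≤n))) ⟨
    ψ n *ᴾ ψ e -ᴾ ψ 0 *ᴾ ψ n -ᴾ ψ 0 *ᴾ ψ e +ᴾ ψ 0 *ᴾ ψ 0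
      ≈⟨ factor (ψ n) (ψ e) (ψ 0) ⟩
    (ψ n -ᴾ ψ 0) *ᴾ (ψ e -ᴾ ψ 0) ∎
    where
    open ≃-Reasoning
    ψα² = ≃-trans (ψ-*-ψ {α} ℕₚ.≤-refl) (+ᴾ-cong (ψ-≡ α+α≡n+e) (ψ-≡ (ℕₚ.n∸n≡0 α)))
    ψβ² = ≃-trans (ψ-*-ψ {β} ℕₚ.≤-refl) (+ᴾ-cong (ψ-≡ β+β≡n∸e) (ψ-≡ (ℕₚ.n∸n≡0 β)))
    ψαψβ = ≃-trans (ψ-*-ψ β≤α) (+ᴾ-congʳ (ψ e) (ψ-≡ α+β≡n))
    square-of-difference : ∀ a b → (a -ᴾ b) *ᴾ (a -ᴾ b) ≃ (a *ᴾ a +ᴾ b *ᴾ b) -ᴾ (a *ᴾ b +ᴾ a *ᴾ b)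
    square-of-difference = solve-∀ ℤ[t]ᴬ
    rearrange : ∀ p q m e → ((p +ᴾ constᴾ (+ 2)) +ᴾ (q +ᴾ constᴾ (+ 2))) -ᴾ ((m +ᴾ e) +ᴾ (m +ᴾ e)) ≃
                            (p +ᴾ q) -ᴾ constᴾ (+ 2) *ᴾ m -ᴾ constᴾ (+ 2) *ᴾ e +ᴾ constᴾ (+ 2) *ᴾ constᴾ (+ 2)
    rearrange = solve-∀ ℤ[t]ᴬ
    factor : ∀ m e z → m *ᴾ e -ᴾ z *ᴾ m -ᴾ z *ᴾ e +ᴾ z *ᴾ z ≃ (m -ᴾ z) *ᴾ (e -ᴾ z)
    factor = solve-∀ ℤ[t]ᴬ

  ∈I⇒square∈⟨ψₙ-2⟩ : ∀ f → f ∈ GenI n → f ^ᴾ 2 ∈ GenTors n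
  ∈I⇒square∈⟨ψₙ-2⟩ f f∈I with ∈-principal (∈-mono (λ {g} → I⊆⟨D⟩ {g}) f∈I)
  ... | q , f≃qD =
    ∈-resp-≃ (≃-sym f²≃) (∈-* ((q *ᴾ q) *ᴾ (ψ e -ᴾ ψ 0)) (generator∈ {g = ψ n -ᴾ ψ 0} (λ _ → refl)))
    where
    f²≃ : f ^ᴾ 2 ≃ ((q *ᴾ q) *ᴾ (ψ e -ᴾ ψ 0)) *ᴾ (ψ n -ᴾ ψ 0)
    f²≃ = begin
      f *ᴾ (f *ᴾ 1ᴾ)                              ≈⟨ *ᴾ-cong f≃qD (≃-trans (*ᴾ-identityʳ f) f≃qD) ⟩
      (q *ᴾ D) *ᴾ (q *ᴾ D)                        ≈⟨ regroup q D ⟩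
      (q *ᴾ q) *ᴾ (D *ᴾ D)                        ≈⟨ *ᴾ-congˡ (q *ᴾ q) D² ⟩
      (q *ᴾ q) *ᴾ ((ψ n -ᴾ ψ 0) *ᴾ (ψ e -ᴾ ψ 0))  ≈⟨ rotate (q *ᴾ q) (ψ n -ᴾ ψ 0) (ψ e -ᴾ ψ 0) ⟩
      ((q *ᴾ q) *ᴾ (ψ e -ᴾ ψ 0)) *ᴾ (ψ n -ᴾ ψ 0)  ∎
      where
      open ≃-Reasoning
      regroup : ∀ q d → (q *ᴾ d) *ᴾ (q *ᴾ d) ≃ (q *ᴾ q) *ᴾ (d *ᴾ d)
      regroup = solve-∀ ℤ[t]ᴬ
      rotate : ∀ a b c → a *ᴾ (b *ᴾ c) ≃ (a *ᴾ c) *ᴾ b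
      rotate = solve-∀ ℤ[t]ᴬ

  √⟨ψₙ-2⟩⊆I : ∀ f k → f ^ᴾ k ∈ GenTors n → f ∈ GenI n
  √⟨ψₙ-2⟩⊆I f k fᵏ∈ = reduced f k (∈-mono ⟨ψₙ-2⟩⊆I fᵏ∈)
    where
    ⟨ψₙ-2⟩⊆I : ∀ {g} → GenTors n g → g ∈ GenI n
    ⟨ψₙ-2⟩⊆I {g} g≈ = ∈-resp-≃ (≃-sym (≈ᴾ⇒≃ g (ψ n -ᴾ ψ 0) g≈)) ψₙ-ψ₀∈I

  -- The image of φ

  φ-image-σ-invariant : ∀ f g → f ∘ᴾ y ≡ᶜ g → g ∘ᴾ x⁻¹ ≡ᶜ g
  φ-image-σ-invariant f g φf≡g = ≡-trans (σ-≡ᶜ (≡-sym φf≡g)) (≡-trans (σ-φ f) φf≡g)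

  cycCoeff-φ-lincomb : ∀ s {t} → t ≤ n′ →
    cycCoeff t (lincomb s ∘ᴾ y) ≡ ∑ℤ[ k < suc c ] s k ℤ.* (δ k t ℤ.+ δ (n ∸ k) t)
  cycCoeff-φ-lincomb s {t} t≤n′ = ≡.trans
    (homo-∑ ℤ[t]⁺ ℤₚ.+-0-commutativeMonoid (λ f → cycCoeff t (f ∘ᴾ y)) refl
            (λ f g → ≡.trans (cycCoeff-cong t (∘ᴾ-+ f g y)) (cycCoeff-+ t (f ∘ᴾ y) (g ∘ᴾ y))) (suc c) _)
    (Sumℤ.∑-cong (suc c) (λ k k≤c → begin
      cycCoeff t ((s k ·ᴾ basis k) ∘ᴾ y)  ≡⟨ cycCoeff-cong t (∘ᴾ-· (s k) (basis k) y) ⟩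
      cycCoeff t (s k ·ᴾ (basis k ∘ᴾ y))  ≡⟨ cycCoeff-· t (s k) (basis k ∘ᴾ y) ⟩
      s k ℤ.* cycCoeff t (basis k ∘ᴾ y)   ≡⟨ cong (s k ℤ.*_) (cycCoeff-φ-basis (k≤n′ k≤c) t≤n′) ⟩
      s k ℤ.* (δ k t ℤ.+ δ (n ∸ k) t)     ∎))
    where
    open ≡.≡-Reasoning
    k≤n′ = λ {k} (k<1+c : k < suc c) → ℕₚ.≤-trans (ℕₚ.≤-pred k<1+c) c≤n′

  module Odd (n≡1+c+c : n ≡ suc (c + c)) where

    private
      c<n∸k : ∀ {k} → k ≤ c → c < n ∸ k
      c<n∸k {k} k≤c = ℕₚ.≤-trans (ℕₚ.≤-reflexive (≡.sym n∸c≡1+c)) (ℕₚ.∸-monoʳ-≤ n k≤c)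
        where
        n∸c≡1+c = ≡.trans (cong (_∸ c) n≡1+c+c)
                          (≡.trans (ℕₚ.+-∸-assoc 1 (ℕₚ.m≤n+m c c)) (cong suc (ℕₚ.m+n∸m≡n c c)))

      δ-pair-low : ∀ {k t} → k ≤ c → t ≤ c → δ k t ℤ.+ δ (n ∸ k) t ≡ δ k t
      δ-pair-low {k} {t} k≤c t≤c =
        ≡.trans (cong (λ d → δ k t ℤ.+ d) (δ-≢ n∸k≢t)) (ℤₚ.+-identityʳ (δ k t))
        where n∸k≢t = λ n∸k≡t → ℕₚ.<⇒≱ (c<n∸k k≤c) (≡.subst (_≤ c) (≡.sym n∸k≡t) t≤c)

      δ-pair-high : ∀ {k t} → k ≤ c → c < t → t ≤ n → δ k t ℤ.+ δ (n ∸ k) t ≡ δ k (n ∸ t)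
      δ-pair-high {k} {t} k≤c c<t t≤n = ≡.trans (cong (ℤ._+ δ (n ∸ k) t) (δ-≢ k≢t))
        (≡.trans (ℤₚ.+-identityˡ _) (δ-∸ (ℕₚ.≤-trans k≤c (ℕₚ.<⇒≤ c<n)) t≤n))
        where k≢t = λ k≡t → ℕₚ.<⇒≱ c<t (≡.subst (_≤ c) k≡t k≤c)

    σ-invariant⇒φ-image : ∀ g → g ∘ᴾ x⁻¹ ≡ᶜ g → Σ Poly λ f → f ∘ᴾ y ≡ᶜ g
    σ-invariant⇒φ-image g σg≡g = lincomb s , cycCoeff-complete same-coefficients
      where
      s : ℕ → ℤ
      s k = cycCoeff k g
      same-coefficients : ∀ t → t ≤ n′ → cycCoeff t (lincomb s ∘ᴾ y) ≡ cycCoeff t g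
      same-coefficients t t≤n′ with t ℕₚ.≤? c
      ... | yes t≤c = begin
        cycCoeff t (lincomb s ∘ᴾ y)
          ≡⟨ cycCoeff-φ-lincomb s t≤n′ ⟩
        ∑ℤ[ k < suc c ] s k ℤ.* (δ k t ℤ.+ δ (n ∸ k) t)
          ≡⟨ Sumℤ.∑-cong (suc c) (λ k k≤c → cong (s k ℤ.*_) (δ-pair-low (ℕₚ.≤-pred k≤c) t≤c)) ⟩
        ∑ℤ[ k < suc c ] s k ℤ.* δ k t
          ≡⟨ ∑ℤ-δ (suc c) s (s≤s t≤c) ⟩
        cycCoeff t g ∎
        where open ≡.≡-Reasoning
      ... | no  t≰c = begin
        cycCoeff t (lincomb s ∘ᴾ y)
          ≡⟨ cycCoeff-φ-lincomb s t≤n′ ⟩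
        ∑ℤ[ k < suc c ] s k ℤ.* (δ k t ℤ.+ δ (n ∸ k) t)
          ≡⟨ Sumℤ.∑-cong (suc c) (λ k k≤c → cong (s k ℤ.*_) (δ-pair-high (ℕₚ.≤-pred k≤c) c<t t≤n)) ⟩
        ∑ℤ[ k < suc c ] s k ℤ.* δ k (n ∸ t)
          ≡⟨ ∑ℤ-δ (suc c) s (s≤s (n∸k≤c c<t)) ⟩
        cycCoeff (n ∸ t) g
          ≡⟨ cong (λ m → cycCoeff m g) (cycNeg-≡ (ℕₚ.≤-trans (s≤s z≤n) c<t)) ⟨
        cycCoeff (cycNeg t) g
          ≡⟨ cycCoeff-σ g t≤n′ ⟨
        cycCoeff t (g ∘ᴾ x⁻¹)
          ≡⟨ cycCoeff-≡ᶜ t≤n′ σg≡g ⟩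
        cycCoeff t g ∎
        where
        open ≡.≡-Reasoning
        c<t = ℕₚ.≰⇒> t≰c
        t≤n = ℕₚ.m≤n⇒m≤1+n t≤n′

  module Even (n≡2c : n ≡ 2 * c) where

    private
      n≡c+c : n ≡ c + c
      n≡c+c = ≡.trans n≡2c (cong (λ m → c + m) (ℕₚ.+-identityʳ c))

      n∸c≡c : n ∸ c ≡ c
      n∸c≡c = ≡.trans (cong (_∸ c) n≡c+c) (ℕₚ.m+n∸m≡n c c)

      1≤c : 1 ≤ c
      1≤c = ℕₚ.n≢0⇒n>0 (λ c≡0 → ℕₚ.1+n≢0 (≡.trans n≡c+c (cong (λ m → m + m) c≡0)))

      basis≡ψ : ∀ {k} → 1 ≤ k → basis k ≡ ψ k
      basis≡ψ {suc k} _ = refl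

      φ-basis : ∀ {k} → k < c → basis k ∘ᴾ y ≡ᶜ basisEven n k
      φ-basis {zero}  _   = ≃⇒≡ (∘ᴾ-const (+ 1) y)
      φ-basis {suc k} k<c =
        ≡-trans (φ-ψ (suc k)) (≡-+ˡ (X ^ᴾ suc k) (≡-sym (xⁿ⁻ʲ≡x⁻ʲ (suc k) k+1≤n)))
        where k+1≤n = ℕₚ.≤-trans (ℕₚ.<⇒≤ k<c) (ℕₚ.<⇒≤ c<n)

      φ-ψ-c : ψ c ∘ᴾ y ≡ᶜ + 2 ·ᴾ X ^ᴾ c
      φ-ψ-c = begin
        ψ c ∘ᴾ y                   ≈⟨ φ-ψ c ⟩
        X ^ᴾ c +ᴾ x⁻¹ ^ᴾ c         ≈⟨ ≡-+ˡ (X ^ᴾ c) (≡-sym (xⁿ⁻ʲ≡x⁻ʲ c (ℕₚ.<⇒≤ c<n))) ⟩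
        X ^ᴾ c +ᴾ X ^ᴾ (n ∸ c)     ≡⟨ cong (λ m → X ^ᴾ c +ᴾ X ^ᴾ m) n∸c≡c ⟩
        X ^ᴾ c +ᴾ X ^ᴾ c           ≈⟨ ≃⇒≡ (double (X ^ᴾ c)) ⟩
        + 2 ·ᴾ X ^ᴾ c              ∎
        where
        open ≡[_]-Reasoning (GenCyc n)
        double : ∀ p → p +ᴾ p ≃ + 2 ·ᴾ p
        double p = ≃-sym (≃-trans (·ᴾ-distribʳ (+ 1) (+ 1) p) (+ᴾ-cong (·ᴾ-identityˡ p) (·ᴾ-identityˡ p)))

    spanEven-preimage : (ℕ → ℤ) → ℤ → Poly
    spanEven-preimage a b = (∑ᴾ[ k < c ] a k ·ᴾ basis k) +ᴾ b ·ᴾ ψ c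

    φ-spanEven : ∀ a b → spanEven-preimage a b ∘ᴾ y ≡ᶜ spanEven c a b
    φ-spanEven a b = begin
      ((∑ᴾ[ k < c ] a k ·ᴾ basis k) +ᴾ b ·ᴾ ψ c) ∘ᴾ y
        ≈⟨ ≃⇒≡ (∘ᴾ-+ (∑ᴾ[ k < c ] a k ·ᴾ basis k) (b ·ᴾ ψ c) y) ⟩
      (∑ᴾ[ k < c ] a k ·ᴾ basis k) ∘ᴾ y +ᴾ (b ·ᴾ ψ c) ∘ᴾ y
        ≈⟨ ≃⇒≡ (+ᴾ-cong (homo-∑ ℤ[t]⁺ ℤ[t]⁺ (_∘ᴾ y) ≃-refl (λ p q → ∘ᴾ-+ p q y) c _) (∘ᴾ-· b (ψ c) y)) ⟩
      (∑ᴾ[ k < c ] (a k ·ᴾ basis k) ∘ᴾ y) +ᴾ b ·ᴾ (ψ c ∘ᴾ y)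
        ≈⟨ ≡-+ (Sumᶜ.∑-cong c (λ k k<c → ≡-trans (≃⇒≡ (∘ᴾ-· (a k) (basis k) y)) (≡-· (a k) (φ-basis k<c))))
               (≡-· b φ-ψ-c) ⟩
      (∑ᴾ[ k < c ] a k ·ᴾ basisEven n k) +ᴾ b ·ᴾ (+ 2 ·ᴾ X ^ᴾ c)
        ≈⟨ ≃⇒≡ (+ᴾ-congʳ _ (sumᴾ-applyUpTo (λ k → a k ·ᴾ basisEven n k) (λ k → k) c)) ⟨
      sumᴾ (map (λ k → a k ·ᴾ basisEven n k) (upTo c)) +ᴾ b ·ᴾ (+ 2 ·ᴾ X ^ᴾ c)
        ≡⟨ cong (λ m → sumᴾ (map (λ k → a k ·ᴾ basisEven m k) (upTo c)) +ᴾ b ·ᴾ (+ 2 ·ᴾ X ^ᴾ c)) n≡2c ⟩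
      spanEven c a b ∎
      where open ≡[_]-Reasoning (GenCyc n)

    φ-image⇒spanEven : ∀ f g → f ∘ᴾ y ≡ᶜ g → Σ (ℕ → ℤ) λ a → Σ ℤ λ b → g ≡ᶜ spanEven c a b
    φ-image⇒spanEven f g φf≡g = s , s c , (begin
      g                                ≈⟨ φf≡g ⟨
      f ∘ᴾ y                           ≈⟨ φ-≡ᴵ (proj₂ (spanned f)) ⟩
      lincomb s ∘ᴾ y                   ≡⟨ cong (λ p → ((∑ᴾ[ k < c ] s k ·ᴾ basis k) +ᴾ s c ·ᴾ p) ∘ᴾ y) (basis≡ψ 1≤c) ⟩
      spanEven-preimage s (s c) ∘ᴾ y   ≈⟨ φ-spanEven s (s c) ⟩
      spanEven c s (s c)               ∎)
      where
      open ≡[_]-Reasoning (GenCyc n)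
      s = proj₁ (spanned f)

    spanEven⇒φ-image : ∀ g a b → g ≡ᶜ spanEven c a b → Σ Poly λ f → f ∘ᴾ y ≡ᶜ g
    spanEven⇒φ-image g a b g≡ = spanEven-preimage a b , ≡-trans (φ-spanEven a b) (≡-sym g≡)

halve : ∀ n → Σ ℕ λ c → n ≡ c + c ⊎ n ≡ suc (c + c)
halve zero    = 0 , inj₁ refl
halve (suc n) with halve n
... | c , inj₁ n≡c+c   = c , inj₂ (cong suc n≡c+c)
... | c , inj₂ n≡1+c+c = suc c , inj₁ (cong suc (≡.trans n≡1+c+c (≡.sym (ℕₚ.+-suc c c))))

fromModCyc : ∀ n p q → p ≡ q modCyc n → p ≡[ GenCyc n ] q
fromModCyc n p q p-q∈ = ≡-by (mem p-q∈)

toModCyc : ∀ n {p q} → p ≡[ GenCyc n ] q → p ≡ q modCyc n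
toModCyc n p≡q = unmem (difference∈ p≡q)

image-odd : ∀ n′ m → suc n′ ≡ 1 + 2 * m → ∀ g →
            ((Σ Poly λ f → φ (suc n′) f ≡ g modCyc (suc n′)) → σ (suc n′) g ≡ g modCyc (suc n′))
            × (σ (suc n′) g ≡ g modCyc (suc n′) → Σ Poly λ f → φ (suc n′) f ≡ g modCyc (suc n′))
image-odd n′ m n≡1+2m g =
  (λ (f , φf≡g) → toModCyc n (φ-image-σ-invariant f g (fromModCyc n (f ∘ᴾ y) g φf≡g))) ,
  (λ σg≡g → let (f , φf≡g) = σ-invariant⇒φ-image g (fromModCyc n (g ∘ᴾ x⁻¹) g σg≡g)
            in f , toModCyc n φf≡g)
  where
  n≡1+m+m = ≡.trans n≡1+2m (cong (λ k → suc (m + k)) (ℕₚ.+-identityʳ m))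
  open Halves n′ m (inj₂ n≡1+m+m)
  open Odd n≡1+m+m

image-even : ∀ n′ m → suc n′ ≡ 2 * m → ∀ g →
             ((Σ Poly λ f → φ (suc n′) f ≡ g modCyc (suc n′)) →
                Σ (ℕ → ℤ) λ a → Σ ℤ λ b → g ≡ spanEven m a b modCyc (suc n′))
             × ((Σ (ℕ → ℤ) λ a → Σ ℤ λ b → g ≡ spanEven m a b modCyc (suc n′)) →
                Σ Poly λ f → φ (suc n′) f ≡ g modCyc (suc n′))
image-even n′ m n≡2m g =
  (λ (f , φf≡g) → let (a , b , g≡) = φ-image⇒spanEven f g (fromModCyc n (f ∘ᴾ y) g φf≡g)
                  in a , b , toModCyc n g≡) ,
  (λ (a , b , g≡) → let (f , φf≡g) = spanEven⇒φ-image g a b (fromModCyc n g (spanEven m a b) g≡)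
                    in f , toModCyc n φf≡g)
  where
  open Halves n′ m (inj₁ (≡.trans n≡2m (cong (λ k → m + k) (ℕₚ.+-identityʳ m))))
  open Even n≡2m

proposition10p3 : (n : ℕ) → 1 ≤ n →
    -- (1) Y(n) flat over ℤ (= ℤ-torsion-free, ℤ being a PID)
    ((c : ℤ) (f : Poly) → c ≢ + 0 → (c ·ᴾ f) ∈⟨ GenI n ⟩ → f ∈⟨ GenI n ⟩)
    -- (1) Y(n) reduced
    × ((f : Poly) (k : ℕ) → (f ^ᴾ k) ∈⟨ GenI n ⟩ → f ∈⟨ GenI n ⟩)
    -- (1) Y(n) → Y[n]_red is an isomorphism: I = √(ψ_n − 2)
    × ((f : Poly) → (f ∈⟨ GenI n ⟩ → f ∈√⟨ GenTors n ⟩)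
                  × (f ∈√⟨ GenTors n ⟩ → f ∈⟨ GenI n ⟩))
    -- (2) y ↦ x + x⁻¹ is well defined on ℤ[y]/I
    × ((f g : Poly) → (f -ᴾ g) ∈⟨ GenI n ⟩ → φ n f ≡ φ n g modCyc n)
    -- (2) and injective
    × ((f g : Poly) → φ n f ≡ φ n g modCyc n → (f -ᴾ g) ∈⟨ GenI n ⟩)
    -- (2) n odd: image = σ-invariants
    × ((m : ℕ) → n ≡ 1 + 2 * m → (g : Poly) →
         ((Σ Poly λ f → φ n f ≡ g modCyc n) → σ n g ≡ g modCyc n)
         × (σ n g ≡ g modCyc n → Σ Poly λ f → φ n f ≡ g modCyc n))
    -- (2) n even: image = ℤ-span of {1, x^k + x^(-k) for 0<k<n/2, 2x^(n/2)}
    × ((m : ℕ) → n ≡ 2 * m → (g : Poly) →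
         ((Σ Poly λ f → φ n f ≡ g modCyc n) →
            Σ (ℕ → ℤ) λ a → Σ ℤ λ b → g ≡ spanEven m a b modCyc n)
         × ((Σ (ℕ → ℤ) λ a → Σ ℤ λ b → g ≡ spanEven m a b modCyc n) →
            Σ Poly λ f → φ n f ≡ g modCyc n))
proposition10p3 (suc n′) _ =
  (λ a f a≢0 af∈I → unmem (torsion-free a f a≢0 (mem af∈I))) ,
  (λ f k fᵏ∈I → unmem (reduced f k (mem fᵏ∈I))) ,
  (λ f → (λ f∈I → 2 , unmem (∈I⇒square∈⟨ψₙ-2⟩ f (mem f∈I))) ,
         (λ (k , fᵏ∈) → unmem (√⟨ψₙ-2⟩⊆I f k (mem fᵏ∈)))) ,
  (λ f g f-g∈I → toModCyc (suc n′) (φ-≡ᴵ {f} {g} (≡-by (mem f-g∈I)))) ,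
  (λ f g φf≡φg → unmem (φ-injective f g (fromModCyc n (f ∘ᴾ y) (g ∘ᴾ y) φf≡φg))) ,
  image-odd n′ ,
  image-even n′
  where open Halves n′ (proj₁ (halve (suc n′))) (proj₂ (halve (suc n′)))
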